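{- For integers $k\geq 2$ and $n\geq 1$ let $\mathcal{B}_n(1^k)$ be the set of binary words of length $n$ containing no $k$ consecutive 1s, and let $v_{n,k}$ be the total number of 1s over all words of $\mathcal{B}_n(1^k)$. Then $$\lim_{k\to\infty}\lim_{n\to\infty}\frac{v_{n,k}}{n\cdot|\mathcal{B}_n(1^k)|}=\frac12.$$ -}

module Defs where

open import Data.Bool using (Bool; true; false)
open import Data.Bool.Properties using () renaming (_≟_ to _≟ᵇ_)
open import Data.Nat using (ℕ; zero; suc; _*_)
open import Data.List using (List; []; _∷_; [_]; map; _++_; filter; length; replicate)
open import Data.Nat.ListAction using (sum)
open import Data.List.Relation.Binary.Infix.Heterogeneous using (Infix)
open import Data.List.Relation.Binary.Infix.Heterogeneous.Properties using (infix?)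
open import Data.Integer using (+_)
open import Data.Rational using (ℚ; 0ℚ; _/_)
open import Relation.Binary.PropositionalEquality using (_≡_)
open import Relation.Nullary using (¬_)
open import Relation.Nullary.Decidable using (¬?)

-- All binary words (true = 1, false = 0) of length n, each listed exactly once.
words : ℕ → List (List Bool)
words zero    = [ [] ]
words (suc n) = map (false ∷_) (words n) ++ map (true ∷_) (words n)

Contains1^ : ℕ → List Bool → Set
Contains1^ k w = Infix _≡_ (replicate k true) w

B : ℕ → ℕ → List (List Bool)
B n k = filter (λ w → ¬? (infix? _≟ᵇ_ (replicate k true) w)) (words n)

v : ℕ → ℕ → ℕ
v n k = sum (map (λ w → length (filter (_≟ᵇ true) w)) (B n k))

-- p / q as a rational; only used with q ≥ 1 (q = 0 is given the junk value 0).
ratio : ℕ → ℕ → ℚ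
ratio p zero    = 0ℚ
ratio p (suc q) = (+ p) / suc q

a : ℕ → ℕ → ℚ
a n k = ratio (v n k) (n * length (B n k))

{-# OPTIONS --safe #-}
module Submission where

-- Splitting a word on its first letter gives linear recurrences for the size of B_n(1^k) and for
-- the total numbers of ones and zeros in it, once the admissible length of the initial run of ones
-- is recorded as a second index. Two inequalities carried along these recurrences,
-- #ones ≤ #zeros and k·#zeros ≤ k·#ones + n·|B_n(1^k)|, give ½ − 1/(2k) ≤ a_{n,k} ≤ ½ for all n.
--
-- For fixed k let c be the k-bonacci sequence with c (n + 1) = |B_n(1^k)|. The zeros form the
-- convolution Σ_{q<n} c(q+1)·c(n−q), so 1 − a_{n,k} is an average of ratios c(m)·c(u)/c(m+u).
-- For fixed m, both u ↦ c(m)·c(u) and u ↦ c(m+u) satisfy c(t+k) = Σ_{j<k} c(t+j), and this positive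
-- recurrence shrinks the range of the quotient of two solutions on k consecutive terms by a fixed
-- factor every k steps. So the ratios converge uniformly as m, u → ∞, and (a_{n,k})_n is Cauchy.

open import Data.Nat using (ℕ)

module Words where

  open import Defs
  open import Data.Bool using (Bool; true; false)
  open import Data.Bool.Properties using () renaming (_≟_ to _≟ᵇ_)
  open import Data.Nat
  open import Data.Nat.Properties
  open import Data.List using (List; []; _∷_; map; _++_; filter; length; replicate)
  open import Data.List.Properties using (filter-++; filter-≐; filter-none; length-++; length-map; map-++; map-∘)
  open import Data.Nat.Tactic.RingSolver using (solve-∀)
  open import Data.List.Relation.Unary.All using (universal)
  open import Data.Nat.ListAction using (sum)
  open import Data.Nat.ListAction.Properties using (sum-++)
  open import Data.List.Relation.Binary.Infix.Heterogeneous using (here; there)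
  open import Data.List.Relation.Binary.Infix.Heterogeneous.Properties using (infix?)
  open import Data.List.Relation.Binary.Prefix.Heterogeneous using (Prefix; []; _∷_)
  open import Data.List.Relation.Binary.Prefix.Heterogeneous.Properties using (prefix?)
  open import Data.Product using (_×_; _,_; proj₁)
  open import Data.Sum using (inj₁; inj₂)
  open import Function using (_∘_)
  open import Level using (0ℓ)
  open import Relation.Binary.PropositionalEquality
  open import Relation.Nullary using (¬_; does)
  open import Relation.Nullary.Decidable using (¬?; _×-dec_)
  open import Relation.Unary using (Pred; Decidable; _≐_)

  filter-map : ∀ {A B : Set} {P : Pred B 0ℓ} (P? : Decidable P) (f : A → B) (xs : List A) →
               filter P? (map f xs) ≡ map f (filter (P? ∘ f) xs)
  filter-map P? f []       = refl
  filter-map P? f (x ∷ xs) with does (P? (f x))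
  ... | true  = cong (f x ∷_) (filter-map P? f xs)
  ... | false = filter-map P? f xs

  ones : List Bool → ℕ
  ones w = length (filter (_≟ᵇ true) w)

  module RunAvoidance (k' : ℕ) where

    k : ℕ
    k = suc k'

    Starts1^ : ℕ → List Bool → Set
    Starts1^ i w = Prefix _≡_ (replicate i true) w

    -- The index i bounds the initial run of ones; Restricted k is membership in B_n(1^k).
    Restricted : ℕ → List Bool → Set
    Restricted i w = ¬ Contains1^ k w × ¬ Starts1^ i w

    restricted? : ∀ i → Decidable (Restricted i)
    restricted? i w = ¬? (infix? _≟ᵇ_ (replicate k true) w) ×-dec ¬? (prefix? _≟ᵇ_ (replicate i true) w)

    restricted : ℕ → ℕ → List (List Bool)
    restricted n i = filter (restricted? i) (words n)

    Starts1^-mono : ∀ {i j} w → j ≤ i → Starts1^ i w → Starts1^ j w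
    Starts1^-mono w       z≤n       p        = []
    Starts1^-mono (_ ∷ w) (s≤s j≤i) (e ∷ p) = e ∷ Starts1^-mono w j≤i p

    Restricted-k : (λ w → ¬ Contains1^ k w) ≐ Restricted k
    Restricted-k = (λ ¬c → ¬c , ¬c ∘ here) , proj₁

    Restricted-false : ∀ i → Restricted (suc i) ∘ (false ∷_) ≐ Restricted k
    Restricted-false i = (λ (¬c , _) → ¬c ∘ there , ¬c ∘ there ∘ here)
                       , (λ (¬c , _) → (λ { (here (() ∷ _)) ; (there c) → ¬c c }) , λ { (() ∷ _) })

    Restricted-true : ∀ {i} → i ≤ k' → Restricted (suc i) ∘ (true ∷_) ≐ Restricted i
    Restricted-true {i} i≤k' = (λ (¬c , ¬s) → ¬c ∘ there , ¬s ∘ (refl ∷_))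
                             , (λ (¬c , ¬s) → (λ { (here (_ ∷ p)) → ¬s (Starts1^-mono _ i≤k' p)
                                                 ; (there c) → ¬c c })
                                            , λ { (_ ∷ p) → ¬s p })

    restricted-zero : ∀ n → restricted n 0 ≡ []
    restricted-zero n = filter-none (restricted? 0) (universal (λ _ (_ , ¬s) → ¬s []) (words n))

    restricted-suc : ∀ n {i} → i ≤ k' →
                     restricted (suc n) (suc i) ≡ map (false ∷_) (restricted n k) ++ map (true ∷_) (restricted n i)
    restricted-suc n {i} i≤k' = begin
      filter R? (map (false ∷_) (words n) ++ map (true ∷_) (words n))
        ≡⟨ filter-++ R? (map (false ∷_) (words n)) _ ⟩
      filter R? (map (false ∷_) (words n)) ++ filter R? (map (true ∷_) (words n))
        ≡⟨ cong₂ _++_ (filter-map R? (false ∷_) (words n)) (filter-map R? (true ∷_) (words n)) ⟩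
      map (false ∷_) (filter (R? ∘ (false ∷_)) (words n)) ++ map (true ∷_) (filter (R? ∘ (true ∷_)) (words n))
        ≡⟨ cong₂ (λ u v → map (false ∷_) u ++ map (true ∷_) v)
                 (filter-≐ (R? ∘ (false ∷_)) (restricted? k) (Restricted-false i) (words n))
                 (filter-≐ (R? ∘ (true ∷_)) (restricted? i) (Restricted-true i≤k') (words n)) ⟩
      map (false ∷_) (restricted n k) ++ map (true ∷_) (restricted n i) ∎
      where open ≡-Reasoning
            R? : Decidable (Restricted (suc i))
            R? = restricted? (suc i)

    B≡restricted : ∀ n → B n k ≡ restricted n k
    B≡restricted n = filter-≐ _ (restricted? k) Restricted-k (words n)

    -- The size of restricted n i and its total numbers of ones and of zeros, split on the first letter.
    #words : ℕ → ℕ → ℕ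
    #words zero    zero    = 0
    #words zero    (suc i) = 1
    #words (suc n) zero    = 0
    #words (suc n) (suc i) = #words n k + #words n i

    #ones : ℕ → ℕ → ℕ
    #ones zero    i       = 0
    #ones (suc n) zero    = 0
    #ones (suc n) (suc i) = #ones n k + (#ones n i + #words n i)

    #zeros : ℕ → ℕ → ℕ
    #zeros zero    i       = 0
    #zeros (suc n) zero    = 0
    #zeros (suc n) (suc i) = (#zeros n k + #words n k) + #zeros n i

    length-restricted : ∀ n {i} → i ≤ k → length (restricted n i) ≡ #words n i
    length-restricted zero    {zero}  _         = refl
    length-restricted zero    {suc i} _         = refl
    length-restricted (suc n) {zero}  _         = cong length (restricted-zero (suc n))
    length-restricted (suc n) {suc i} (s≤s i≤k') = begin
      length (restricted (suc n) (suc i))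
        ≡⟨ cong length (restricted-suc n i≤k') ⟩
      length (map (false ∷_) (restricted n k) ++ map (true ∷_) (restricted n i))
        ≡⟨ length-++ (map (false ∷_) (restricted n k)) ⟩
      length (map (false ∷_) (restricted n k)) + length (map (true ∷_) (restricted n i))
        ≡⟨ cong₂ _+_ (length-map _ (restricted n k)) (length-map _ (restricted n i)) ⟩
      length (restricted n k) + length (restricted n i)
        ≡⟨ cong₂ _+_ (length-restricted n ≤-refl) (length-restricted n (m≤n⇒m≤1+n i≤k')) ⟩
      #words n k + #words n i ∎
      where open ≡-Reasoning

    sum-ones-true∷ : ∀ ws → sum (map (ones ∘ (true ∷_)) ws) ≡ sum (map ones ws) + length ws
    sum-ones-true∷ []       = refl
    sum-ones-true∷ (w ∷ ws) = begin
      suc (ones w) + sum (map (ones ∘ (true ∷_)) ws) ≡⟨ cong (suc (ones w) +_) (sum-ones-true∷ ws) ⟩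
      suc (ones w) + (sum (map ones ws) + length ws)  ≡⟨ regroup (ones w) (sum (map ones ws)) (length ws) ⟩
      ones w + sum (map ones ws) + suc (length ws)    ∎
      where open ≡-Reasoning
            regroup : ∀ o s l → suc o + (s + l) ≡ o + s + suc l
            regroup = solve-∀

    ones-restricted : ∀ n {i} → i ≤ k → sum (map ones (restricted n i)) ≡ #ones n i
    ones-restricted zero    {zero}  _         = refl
    ones-restricted zero    {suc i} _         = refl
    ones-restricted (suc n) {zero}  _         = cong (sum ∘ map ones) (restricted-zero (suc n))
    ones-restricted (suc n) {suc i} (s≤s i≤k') = begin
      sum (map ones (restricted (suc n) (suc i)))
        ≡⟨ cong (sum ∘ map ones) (restricted-suc n i≤k') ⟩
      sum (map ones (map (false ∷_) Bk ++ map (true ∷_) Bi))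
        ≡⟨ cong sum (map-++ ones (map (false ∷_) Bk) _) ⟩
      sum (map ones (map (false ∷_) Bk) ++ map ones (map (true ∷_) Bi))
        ≡⟨ sum-++ (map ones (map (false ∷_) Bk)) _ ⟩
      sum (map ones (map (false ∷_) Bk)) + sum (map ones (map (true ∷_) Bi))
        ≡⟨ cong₂ _+_ (cong sum (sym (map-∘ Bk))) (cong sum (sym (map-∘ Bi))) ⟩
      sum (map ones Bk) + sum (map (ones ∘ (true ∷_)) Bi)
        ≡⟨ cong (sum (map ones Bk) +_) (sum-ones-true∷ Bi) ⟩
      sum (map ones Bk) + (sum (map ones Bi) + length Bi)
        ≡⟨ cong₂ (λ u v → u + (v + length Bi)) (ones-restricted n ≤-refl) (ones-restricted n i≤k) ⟩
      #ones n k + (#ones n i + length Bi)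
        ≡⟨ cong (λ u → #ones n k + (#ones n i + u)) (length-restricted n i≤k) ⟩
      #ones n k + (#ones n i + #words n i) ∎
      where open ≡-Reasoning
            Bk Bi : List (List Bool)
            Bk = restricted n k
            Bi = restricted n i
            i≤k : i ≤ k
            i≤k = m≤n⇒m≤1+n i≤k'

    length-B : ∀ n → length (B n k) ≡ #words n k
    length-B n = trans (cong length (B≡restricted n)) (length-restricted n ≤-refl)

    v≡#ones : ∀ n → v n k ≡ #ones n k
    v≡#ones n = trans (cong (sum ∘ map ones) (B≡restricted n)) (ones-restricted n ≤-refl)

    #words-0 : ∀ n → #words n 0 ≡ 0
    #words-0 zero    = refl
    #words-0 (suc n) = refl

    #words-pos : ∀ n i → 1 ≤ #words n (suc i)
    #words-pos zero    i = ≤-refl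
    #words-pos (suc n) i = ≤-trans (#words-pos n k') (m≤m+n _ _)

    #words-mono : ∀ n {i j} → i ≤ j → #words n i ≤ #words n j
    #words-mono zero    {zero}          _         = z≤n
    #words-mono zero    {suc i} {suc j} _         = ≤-refl
    #words-mono (suc n) {zero}          _         = z≤n
    #words-mono (suc n) {suc i} {suc j} (s≤s i≤j) = +-monoʳ-≤ (#words n k) (#words-mono n i≤j)

    #ones+#zeros : ∀ n i → #ones n i + #zeros n i ≡ n * #words n i
    #ones+#zeros zero    i       = refl
    #ones+#zeros (suc n) zero    = sym (*-zeroʳ (suc n))
    #ones+#zeros (suc n) (suc i) = begin
      (Vk + (Vi + Gi)) + ((Zk + Gk) + Zi) ≡⟨ regroup Vk Vi Gi Zk Gk Zi ⟩
      (Vk + Zk) + (Vi + Zi) + (Gk + Gi)   ≡⟨ cong₂ (λ u w → u + w + (Gk + Gi)) (#ones+#zeros n k) (#ones+#zeros n i) ⟩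
      n * Gk + n * Gi + (Gk + Gi)         ≡⟨ factor n Gk Gi ⟩
      suc n * (Gk + Gi)                   ∎
      where open ≡-Reasoning
            Vk Vi Zk Zi Gk Gi : ℕ
            Vk = #ones n k
            Vi = #ones n i
            Zk = #zeros n k
            Zi = #zeros n i
            Gk = #words n k
            Gi = #words n i
            regroup : ∀ vk vi gi zk gk zi → (vk + (vi + gi)) + ((zk + gk) + zi) ≡ (vk + zk) + (vi + zi) + (gk + gi)
            regroup = solve-∀
            factor : ∀ n gk gi → n * gk + n * gi + (gk + gi) ≡ suc n * (gk + gi)
            factor = solve-∀

    #ones≤#zeros : ∀ n {i} → i ≤ k → #ones n i ≤ #zeros n i
    #ones≤#zeros zero    _         = z≤n
    #ones≤#zeros (suc n) {zero} _  = z≤n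
    #ones≤#zeros (suc n) {suc i} (s≤s i≤k') = begin
      #ones n k + (#ones n i + #words n i)    ≤⟨ +-mono-≤ (#ones≤#zeros n ≤-refl) (+-mono-≤ (#ones≤#zeros n i≤k) (#words-mono n i≤k)) ⟩
      #zeros n k + (#zeros n i + #words n k)  ≡⟨ regroup (#zeros n k) (#zeros n i) (#words n k) ⟩
      #zeros n k + #words n k + #zeros n i    ∎
      where open ≤-Reasoning
            i≤k = m≤n⇒m≤1+n i≤k'
            regroup : ∀ zk zi gk → zk + (zi + gk) ≡ zk + gk + zi
            regroup = solve-∀

    #words-ratio : ∀ n {i j} → i ≤ j → j ≤ k → i * #words n j ≤ j * #words n i
    #words-ratio n       {zero}          _         _ = z≤n
    #words-ratio zero    {suc i} {suc j} i≤j       _ = *-monoˡ-≤ 1 i≤j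
    #words-ratio (suc n) {suc i} {suc j} (s≤s i≤j) (s≤s j≤k') with m≤n⇒m<n∨m≡n i≤j
    ... | inj₂ refl = ≤-refl
    ... | inj₁ i<j  = begin
      suc i * (Gk + Gj)           ≡⟨ expand i Gk Gj ⟩
      suc i * Gk + (Gj + i * Gj)  ≤⟨ +-monoʳ-≤ (suc i * Gk) (+-mono-≤ (#words-mono n j≤k) (#words-ratio n i≤j j≤k)) ⟩
      suc i * Gk + (Gk + j * Gi)  ≡⟨ collect i Gk j Gi ⟩
      suc (suc i) * Gk + j * Gi   ≤⟨ +-mono-≤ (*-monoˡ-≤ Gk (s≤s i<j)) (m≤n+m (j * Gi) Gi) ⟩
      suc j * Gk + (Gi + j * Gi)  ≡⟨ expand j Gk Gi ⟨
      suc j * (Gk + Gi)           ∎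
      where open ≤-Reasoning
            Gk Gi Gj : ℕ
            Gk = #words n k
            Gi = #words n i
            Gj = #words n j
            j≤k : j ≤ k
            j≤k = m≤n⇒m≤1+n j≤k'
            expand : ∀ i gk gj → suc i * (gk + gj) ≡ suc i * gk + (gj + i * gj)
            expand = solve-∀
            collect : ∀ i gk j gi → suc i * gk + (gk + j * gi) ≡ suc (suc i) * gk + j * gi
            collect = solve-∀

    -- Generalised over the initial-run index i = k ∸ d for the induction; at i = k it says that
    -- at least a fraction ½ − 1/(2k) of all letters are ones.
    #zeros-bound : ∀ n {i} d → i + d ≡ k → k * #zeros n i ≤ k * #ones n i + (n + d) * #words n i
    #zeros-bound zero    {i}     d _ = ≤-trans (≤-reflexive (*-zeroʳ k)) z≤n
    #zeros-bound (suc n) {zero}  d _ = ≤-trans (≤-reflexive (*-zeroʳ k)) z≤n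
    #zeros-bound (suc n) {suc i} d i+d≡k = step i+d≡k
      (#zeros-bound n 0 (+-identityʳ k))
      (#zeros-bound n (suc d) (trans (+-suc i d) i+d≡k))
      (#words-ratio n i≤k ≤-refl)
      where
      i≤k : i ≤ k
      i≤k = ≤-trans (m≤m+n i d) (≤-trans (n≤1+n (i + d)) (≤-reflexive i+d≡k))
      step : ∀ {K Vk Vi Zk Zi Gk Gi} → suc (i + d) ≡ K →
             K * Zk ≤ K * Vk + (n + 0) * Gk → K * Zi ≤ K * Vi + (n + suc d) * Gi → i * Gk ≤ K * Gi →
             K * ((Zk + Gk) + Zi) ≤ K * (Vk + (Vi + Gi)) + (suc n + d) * (Gk + Gi)
      step {Vk = Vk} {Vi} {Zk} {Zi} {Gk} {Gi} refl hk hi hr = begin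
        K * ((Zk + Gk) + Zi)                                             ≡⟨ split i d Zk Gk Zi ⟩
        K * Zk + K * Zi + (i * Gk + suc d * Gk)                          ≤⟨ +-mono-≤ (+-mono-≤ hk hi) (+-monoˡ-≤ (suc d * Gk) hr) ⟩
        (K * Vk + (n + 0) * Gk) + (K * Vi + (n + suc d) * Gi) + (K * Gi + suc d * Gk) ≡⟨ join i d n Vk Vi Gk Gi ⟩
        K * (Vk + (Vi + Gi)) + (suc n + d) * (Gk + Gi)                    ∎
        where open ≤-Reasoning
              K : ℕ
              K = suc (i + d)
              split : ∀ i d zk gk zi → suc (i + d) * ((zk + gk) + zi)
                                       ≡ suc (i + d) * zk + suc (i + d) * zi + (i * gk + suc d * gk)
              split = solve-∀
              join : ∀ i d n vk vi gk gi →
                     (suc (i + d) * vk + (n + 0) * gk) + (suc (i + d) * vi + (n + suc d) * gi) + (suc (i + d) * gi + suc d * gk)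
                     ≡ suc (i + d) * (vk + (vi + gi)) + (suc n + d) * (gk + gi)
              join = solve-∀

module RationalLemmas where

  open import Level using (0ℓ)
  open import Data.Nat as ℕ using (ℕ; zero; suc; z≤n; s≤s)
  import Data.Nat.Properties as ℕ
  import Data.Nat.Coprimality as Coprime
  import Data.Integer as ℤ
  import Data.Integer.Properties as ℤ
  open import Data.Rational
  open import Data.Rational.Properties
  open import Data.Rational.Unnormalised as ℚᵘ using (mkℚᵘ; *≡*; *≤*; *<*)
  import Data.Rational.Unnormalised.Properties as ℚᵘ
  open import Data.Product using (_×_; _,_; proj₁; proj₂; ∃-syntax)
  open import Data.Sum using (inj₁; inj₂; [_,_]′)
  open import Relation.Binary.PropositionalEquality
  open import Relation.Nullary.Decidable.Core using (dec⇒maybe)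
  open import Algebra.Definitions.RawSemiring +-*-rawSemiring using (_^_)
  import Tactic.RingSolver.Core.AlmostCommutativeRing as ACR

  ℚ-ring : ACR.AlmostCommutativeRing 0ℓ 0ℓ
  ℚ-ring = ACR.fromCommutativeRing +-*-commutativeRing (λ p → dec⇒maybe (0ℚ ≟ p))

  open import Tactic.RingSolver.NonReflective ℚ-ring using (solve; _⊜_; _⊕_; _⊗_; ⊝_; Κ)

  -- Built with the constructor rather than as + n / 1, so that it never unfolds into a gcd normalisation.
  fromℕ : ℕ → ℚ
  fromℕ n = mkℚ (ℤ.+ n) 0 (Coprime.sym (Coprime.1-coprimeTo n))

  fromℕ-+ : ∀ m n → fromℕ (m ℕ.+ n) ≡ fromℕ m + fromℕ n
  fromℕ-+ m n = toℚᵘ-injective (ℚᵘ.≃-trans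
    (*≡* (cong (ℤ._* ℤ.+ 1) (trans (ℤ.pos-+ m n) (sym (cong₂ ℤ._+_ (ℤ.*-identityʳ (ℤ.+ m)) (ℤ.*-identityʳ (ℤ.+ n)))))))
    (ℚᵘ.≃-sym (toℚᵘ-homo-+ (fromℕ m) (fromℕ n))))

  fromℕ-* : ∀ m n → fromℕ (m ℕ.* n) ≡ fromℕ m * fromℕ n
  fromℕ-* m n = toℚᵘ-injective (ℚᵘ.≃-trans (*≡* (cong (ℤ._* ℤ.+ 1) (ℤ.pos-* m n))) (ℚᵘ.≃-sym (toℚᵘ-homo-* (fromℕ m) (fromℕ n))))

  fromℕ-mono-≤ : ∀ {m n} → m ℕ.≤ n → fromℕ m ≤ fromℕ n
  fromℕ-mono-≤ m≤n = toℚᵘ-cancel-≤ (*≤* (ℤ.*-monoʳ-≤-nonNeg (ℤ.+ 1) (ℤ.+≤+ m≤n)))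

  fromℕ-mono-< : ∀ {m n} → m ℕ.< n → fromℕ m < fromℕ n
  fromℕ-mono-< m<n = toℚᵘ-cancel-< (*<* (ℤ.*-monoʳ-<-pos (ℤ.+ 1) (ℤ.+<+ m<n)))

  0≤fromℕ : ∀ n → 0ℚ ≤ fromℕ n
  0≤fromℕ n = fromℕ-mono-≤ {0} {n} z≤n

  /-*-denominator : ∀ p q → (ℤ.+ p / suc q) * fromℕ (suc q) ≡ fromℕ p
  /-*-denominator p q = toℚᵘ-injective (begin
    toℚᵘ ((ℤ.+ p / suc q) * fromℕ (suc q))              ≈⟨ toℚᵘ-homo-* (ℤ.+ p / suc q) (fromℕ (suc q)) ⟩
    toℚᵘ (ℤ.+ p / suc q) ℚᵘ.* mkℚᵘ (ℤ.+ suc q) 0        ≈⟨ ℚᵘ.*-congʳ (toℚᵘ-fromℚᵘ (mkℚᵘ (ℤ.+ p) q)) ⟩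
    mkℚᵘ (ℤ.+ p) q ℚᵘ.* mkℚᵘ (ℤ.+ suc q) 0              ≈⟨ *≡* (trans (ℤ.*-identityʳ (ℤ.+ p ℤ.* ℤ.+ suc q))
                                                                (cong (λ d → ℤ.+ p ℤ.* ℤ.+ d) (sym (ℕ.*-identityʳ (suc q))))) ⟩
    mkℚᵘ (ℤ.+ p) 0                                       ∎)
    where open ℚᵘ.≃-Reasoning

  p≤q⇒0≤q-p : ∀ {p q} → p ≤ q → 0ℚ ≤ q - p
  p≤q⇒0≤q-p {p} {q} p≤q = subst (_≤ q - p) (+-inverseʳ p) (+-monoˡ-≤ (- p) p≤q)

  ≤-from-difference : ∀ {p q d} → q - p ≡ d → 0ℚ ≤ d → p ≤ q
  ≤-from-difference {p} {q} q-p≡d 0≤d = subst₂ _≤_ (+-identityˡ p) (q-p+p q p) (+-monoˡ-≤ p (subst (0ℚ ≤_) (sym q-p≡d) 0≤d))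
    where q-p+p : ∀ q p → q - p + p ≡ q
          q-p+p = solve 2 (λ q p → (q ⊕ ⊝ p ⊕ p) ⊜ q) refl

  0≤p+q : ∀ {p q} → 0ℚ ≤ p → 0ℚ ≤ q → 0ℚ ≤ p + q
  0≤p+q = +-mono-≤

  0≤p*q : ∀ {p q} → 0ℚ ≤ p → 0ℚ ≤ q → 0ℚ ≤ p * q
  0≤p*q {p} {q} 0≤p 0≤q = nonNegative⁻¹ (p * q) {{nonNeg*nonNeg⇒nonNeg p {{nonNegative 0≤p}} q {{nonNegative 0≤q}}}}

  *-monoˡ-≤-nonNeg′ : ∀ {p q} r → 0ℚ ≤ r → p ≤ q → r * p ≤ r * q
  *-monoˡ-≤-nonNeg′ r 0≤r = *-monoˡ-≤-nonNeg r {{nonNegative 0≤r}}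

  *-monoʳ-≤-nonNeg′ : ∀ {p q} r → 0ℚ ≤ r → p ≤ q → p * r ≤ q * r
  *-monoʳ-≤-nonNeg′ r 0≤r = *-monoʳ-≤-nonNeg r {{nonNegative 0≤r}}

  *-cancelʳ-≤-pos′ : ∀ {p q} r → 0ℚ < r → p * r ≤ q * r → p ≤ q
  *-cancelʳ-≤-pos′ r 0<r = *-cancelʳ-≤-pos r {{positive 0<r}}

  0≤½ : 0ℚ ≤ ½
  0≤½ = *≤* (ℤ.+≤+ z≤n)

  ½<1 : ½ < 1ℚ
  ½<1 = *<* (ℤ.+<+ (s≤s (s≤s z≤n)))

  ∑ : ℕ → (ℕ → ℚ) → ℚ
  ∑ zero    f = 0ℚ
  ∑ (suc n) f = ∑ n f + f n

  syntax ∑ n (λ j → e) = ∑[ j < n ] e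

  ∑-cong : ∀ n {f g} → (∀ j → f j ≡ g j) → ∑ n f ≡ ∑ n g
  ∑-cong zero    f≗g = refl
  ∑-cong (suc n) f≗g = cong₂ _+_ (∑-cong n f≗g) (f≗g n)

  ∑-+ : ∀ n f g → ∑[ j < n ] (f j + g j) ≡ ∑ n f + ∑ n g
  ∑-+ zero    f g = refl
  ∑-+ (suc n) f g = trans (cong (_+ (f n + g n)) (∑-+ n f g)) (interchange (∑ n f) (∑ n g) (f n) (g n))
    where interchange : ∀ a b c d → (a + b) + (c + d) ≡ (a + c) + (b + d)
          interchange = solve 4 (λ a b c d → (a ⊕ b ⊕ (c ⊕ d)) ⊜ (a ⊕ c ⊕ (b ⊕ d))) refl

  ∑-* : ∀ n a f → ∑[ j < n ] (a * f j) ≡ a * ∑ n f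
  ∑-* zero    a f = sym (*-zeroʳ a)
  ∑-* (suc n) a f = trans (cong (_+ a * f n) (∑-* n a f)) (sym (*-distribˡ-+ a (∑ n f) (f n)))

  ∑-difference : ∀ n f g → ∑[ j < n ] (f j - g j) ≡ ∑ n f - ∑ n g
  ∑-difference zero    f g = refl
  ∑-difference (suc n) f g = trans (cong (_+ (f n - g n)) (∑-difference n f g)) (interchange (∑ n f) (∑ n g) (f n) (g n))
    where interchange : ∀ a b c d → (a - b) + (c - d) ≡ (a + c) - (b + d)
          interchange = solve 4 (λ a b c d → (a ⊕ ⊝ b ⊕ (c ⊕ ⊝ d)) ⊜ (a ⊕ c ⊕ ⊝ (b ⊕ d))) refl

  ∑-const : ∀ n c → ∑[ _ < n ] c ≡ fromℕ n * c
  ∑-const zero    c = sym (*-zeroˡ c)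
  ∑-const (suc n) c = begin
    ∑[ _ < n ] c + c         ≡⟨ cong (_+ c) (∑-const n c) ⟩
    fromℕ n * c + c          ≡⟨ distrib (fromℕ n) c ⟩
    (fromℕ n + 1ℚ) * c       ≡⟨ cong (_* c) (fromℕ-+ n 1) ⟨
    fromℕ (n ℕ.+ 1) * c      ≡⟨ cong (λ m → fromℕ m * c) (ℕ.+-comm n 1) ⟩
    fromℕ (suc n) * c        ∎
    where open ≡-Reasoning
          distrib : ∀ x c → x * c + c ≡ (x + 1ℚ) * c
          distrib = solve 2 (λ x c → (x ⊗ c ⊕ c) ⊜ ((x ⊕ Κ 1ℚ) ⊗ c)) refl

  ∑-mono-≤ : ∀ n {f g} → (∀ j → j ℕ.< n → f j ≤ g j) → ∑ n f ≤ ∑ n g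
  ∑-mono-≤ zero    f≤g = ≤-refl
  ∑-mono-≤ (suc n) f≤g = +-mono-≤ (∑-mono-≤ n (λ j j<n → f≤g j (ℕ.m≤n⇒m≤1+n j<n))) (f≤g n ℕ.≤-refl)

  ∑-nonNeg : ∀ n {f} → (∀ j → j ℕ.< n → 0ℚ ≤ f j) → 0ℚ ≤ ∑ n f
  ∑-nonNeg zero    0≤f = ≤-refl
  ∑-nonNeg (suc n) 0≤f = 0≤p+q (∑-nonNeg n (λ j j<n → 0≤f j (ℕ.m≤n⇒m≤1+n j<n))) (0≤f n ℕ.≤-refl)

  ∑-term : ∀ n {f} → (∀ j → j ℕ.< n → 0ℚ ≤ f j) → ∀ {i} → i ℕ.< n → f i ≤ ∑ n f
  ∑-term (suc n) {f} 0≤f {i} i<1+n with ℕ.m≤n⇒m<n∨m≡n (ℕ.≤-pred i<1+n)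
  ... | inj₁ i<n  = ≤-trans (∑-term n (λ j j<n → 0≤f j (ℕ.m≤n⇒m≤1+n j<n)) i<n)
                            (subst (_≤ ∑ n f + f n) (+-identityʳ (∑ n f)) (+-monoʳ-≤ (∑ n f) (0≤f n ℕ.≤-refl)))
  ... | inj₂ refl = subst (_≤ ∑ n f + f i) (+-identityˡ (f i))
                          (+-monoˡ-≤ (f i) (∑-nonNeg n (λ j j<n → 0≤f j (ℕ.m≤n⇒m≤1+n j<n))))

  ∑-split : ∀ m n f → ∑ (m ℕ.+ n) f ≡ ∑ m f + ∑[ j < n ] f (m ℕ.+ j)
  ∑-split m zero    f = trans (cong (λ l → ∑ l f) (ℕ.+-identityʳ m)) (sym (+-identityʳ (∑ m f)))
  ∑-split m (suc n) f = begin
    ∑ (m ℕ.+ suc n) f                                   ≡⟨ cong (λ l → ∑ l f) (ℕ.+-suc m n) ⟩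
    ∑ (m ℕ.+ n) f + f (m ℕ.+ n)                         ≡⟨ cong (_+ f (m ℕ.+ n)) (∑-split m n f) ⟩
    ∑ m f + ∑[ j < n ] f (m ℕ.+ j) + f (m ℕ.+ n)        ≡⟨ +-assoc (∑ m f) _ _ ⟩
    ∑ m f + (∑[ j < n ] f (m ℕ.+ j) + f (m ℕ.+ n))      ∎
    where open ≡-Reasoning

  ∑-front : ∀ n f → ∑ (suc n) f ≡ f 0 + ∑[ j < n ] f (suc j)
  ∑-front n f = trans (∑-split 1 n f) (cong (_+ ∑[ j < n ] f (suc j)) (+-identityˡ (f 0)))

  archimedean : ∀ {ε} → 0ℚ < ε → ∀ m → ∃[ K ] fromℕ m ≤ fromℕ K * ε
  archimedean {ε@(mkℚ (ℤ.+ suc n) d _)} _ m = m ℕ.* suc d , (begin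
    fromℕ m                            ≡⟨ *-identityʳ (fromℕ m) ⟨
    fromℕ m * 1ℚ                       ≤⟨ *-monoˡ-≤-nonNeg′ (fromℕ m) (0≤fromℕ m) (fromℕ-mono-≤ {1} {suc n} (s≤s z≤n)) ⟩
    fromℕ m * fromℕ (suc n)            ≡⟨ cong (λ x → fromℕ m * x) (trans (cong (_* fromℕ (suc d)) (sym (fromℚᵘ-toℚᵘ ε)))
                                                                          (/-*-denominator (suc n) d)) ⟨
    fromℕ m * (ε * fromℕ (suc d))      ≡⟨ regroup (fromℕ m) ε (fromℕ (suc d)) ⟩
    fromℕ m * fromℕ (suc d) * ε        ≡⟨ cong (_* ε) (fromℕ-* m (suc d)) ⟨
    fromℕ (m ℕ.* suc d) * ε            ∎)
    where open ≤-Reasoning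
          regroup : ∀ m e d → m * (e * d) ≡ m * d * e
          regroup = solve 3 (λ m e d → (m ⊗ (e ⊗ d)) ⊜ (m ⊗ d ⊗ e)) refl
  archimedean {mkℚ (ℤ.+ zero) _ _}  (*<* (ℤ.+<+ ()))
  archimedean {mkℚ ℤ.-[1+ _ ] _ _} (*<* ())

  module GeometricDecay {δ : ℚ} (0<δ : 0ℚ < δ) (δ≤1 : δ ≤ 1ℚ) where

    ^-nonNeg : ∀ s → 0ℚ ≤ (1ℚ - δ) ^ s
    ^-nonNeg zero    = 0≤fromℕ 1
    ^-nonNeg (suc s) = 0≤p*q (p≤q⇒0≤q-p δ≤1) (^-nonNeg s)

    bernoulli : ∀ s → (1ℚ - δ) ^ s * (1ℚ + fromℕ s * δ) ≤ 1ℚ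
    bernoulli zero    = ≤-reflexive (base δ)
      where base : ∀ δ → 1ℚ * (1ℚ + 0ℚ * δ) ≡ 1ℚ
            base = solve 1 (λ δ → (Κ 1ℚ ⊗ (Κ 1ℚ ⊕ Κ 0ℚ ⊗ δ)) ⊜ (Κ 1ℚ)) refl
    bernoulli (suc s) = begin
      (1ℚ - δ) ^ suc s * (1ℚ + fromℕ (suc s) * δ)  ≡⟨ cong (λ x → (1ℚ - δ) ^ suc s * (1ℚ + x * δ)) (fromℕ-+ 1 s) ⟩
      (1ℚ - δ) ^ suc s * (1ℚ + (1ℚ + fromℕ s) * δ) ≤⟨ ≤-from-difference (loss ((1ℚ - δ) ^ s) δ (fromℕ s))
                                                        (0≤p*q (0≤p*q (^-nonNeg s) (0≤p*q 0≤δ 0≤δ)) (0≤p+q (0≤fromℕ 1) (0≤fromℕ s))) ⟩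
      (1ℚ - δ) ^ s * (1ℚ + fromℕ s * δ)            ≤⟨ bernoulli s ⟩
      1ℚ                                            ∎
      where open ≤-Reasoning
            0≤δ : 0ℚ ≤ δ
            0≤δ = <⇒≤ 0<δ
            loss : ∀ r δ s → r * (1ℚ + s * δ) - ((1ℚ - δ) * r) * (1ℚ + (1ℚ + s) * δ) ≡ (r * (δ * δ)) * (1ℚ + s)
            loss = solve 3 (λ r δ s → (r ⊗ (Κ 1ℚ ⊕ s ⊗ δ) ⊕ ⊝ ((Κ 1ℚ ⊕ ⊝ δ) ⊗ r ⊗ (Κ 1ℚ ⊕ (Κ 1ℚ ⊕ s) ⊗ δ))) ⊜ (r ⊗ (δ ⊗ δ) ⊗ (Κ 1ℚ ⊕ s))) refl

    geometric-decay : ∀ m {ε} → 0ℚ < ε → ∃[ s ] fromℕ m * (1ℚ - δ) ^ s ≤ ε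
    geometric-decay m {ε} 0<ε with archimedean (positive⁻¹ (ε * δ) {{pos*pos⇒pos ε {{positive 0<ε}} δ {{positive 0<δ}}}}) m
    ... | s , m≤sεδ = s , (begin
      fromℕ m * ρˢ                         ≤⟨ *-monoʳ-≤-nonNeg′ ρˢ (^-nonNeg s) m≤sεδ ⟩
      fromℕ s * (ε * δ) * ρˢ               ≤⟨ ≤-from-difference (gap ε ρˢ (fromℕ s) δ) (0≤p*q (<⇒≤ 0<ε) (^-nonNeg s)) ⟩
      ε * (ρˢ * (1ℚ + fromℕ s * δ))        ≤⟨ *-monoˡ-≤-nonNeg′ ε (<⇒≤ 0<ε) (bernoulli s) ⟩
      ε * 1ℚ                               ≡⟨ *-identityʳ ε ⟩
      ε                                    ∎)
      where open ≤-Reasoning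
            ρˢ : ℚ
            ρˢ = (1ℚ - δ) ^ s
            gap : ∀ e r s δ → e * (r * (1ℚ + s * δ)) - s * (e * δ) * r ≡ e * r
            gap = solve 4 (λ e r s δ → (e ⊗ (r ⊗ (Κ 1ℚ ⊕ s ⊗ δ)) ⊕ ⊝ (s ⊗ (e ⊗ δ) ⊗ r)) ⊜ (e ⊗ r)) refl

  overlapping-intervals : ∀ {a a' η ε} → a ≤ a' + η → a' ≤ a + η → 0ℚ ≤ η → η + η ≤ ε → a' - ε ≤ a × a + η ≤ a' + ε
  overlapping-intervals {a} {a'} {η} {ε} a≤a'+η a'≤a+η 0≤η 2η≤ε =
      ≤-from-difference (lower a a' η ε) (0≤p+q (0≤p+q (p≤q⇒0≤q-p a'≤a+η) (p≤q⇒0≤q-p 2η≤ε)) 0≤η)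
    , ≤-from-difference (upper a a' η ε) (0≤p+q (p≤q⇒0≤q-p a≤a'+η) (p≤q⇒0≤q-p 2η≤ε))
    where lower : ∀ a a' η ε → a - (a' - ε) ≡ ((a + η) - a') + (ε - (η + η)) + η
          lower = solve 4 (λ a a' η ε → (a ⊕ ⊝ (a' ⊕ ⊝ ε)) ⊜ (a ⊕ η ⊕ ⊝ a' ⊕ (ε ⊕ ⊝ (η ⊕ η)) ⊕ η)) refl
          upper : ∀ a a' η ε → (a' + ε) - (a + η) ≡ ((a' + η) - a) + (ε - (η + η))
          upper = solve 4 (λ a a' η ε → (a' ⊕ ε ⊕ ⊝ (a ⊕ η)) ⊜ (a' ⊕ η ⊕ ⊝ a ⊕ (ε ⊕ ⊝ (η ⊕ η)))) refl

  ∑-middle-bounds : ∀ L r {F M lo hi} → (∀ q → q ℕ.< L ℕ.+ (r ℕ.+ L) → 0ℚ ≤ F q × F q ≤ M) →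
                    (∀ j → j ℕ.< r → lo ≤ F (L ℕ.+ j) × F (L ℕ.+ j) ≤ hi) →
                    fromℕ r * lo ≤ ∑ (L ℕ.+ (r ℕ.+ L)) F × ∑ (L ℕ.+ (r ℕ.+ L)) F ≤ fromℕ (L ℕ.+ L) * M + fromℕ r * hi
  ∑-middle-bounds L r {F} {M} {lo} {hi} bounded middle = lower , upper
    where
    open ≤-Reasoning
    Sₕ Sₘ Sₜ : ℚ
    Sₕ = ∑ L F
    Sₘ = ∑[ j < r ] F (L ℕ.+ j)
    Sₜ = ∑[ j < L ] F (L ℕ.+ (r ℕ.+ j))
    split : ∑ (L ℕ.+ (r ℕ.+ L)) F ≡ Sₕ + (Sₘ + Sₜ)
    split = trans (∑-split L (r ℕ.+ L) F) (cong (Sₕ +_) (∑-split r L (λ j → F (L ℕ.+ j))))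
    head : ∀ j → j ℕ.< L → 0ℚ ≤ F j × F j ≤ M
    head j j<L = bounded j (ℕ.≤-trans j<L (ℕ.m≤m+n L (r ℕ.+ L)))
    tail : ∀ j → j ℕ.< L → 0ℚ ≤ F (L ℕ.+ (r ℕ.+ j)) × F (L ℕ.+ (r ℕ.+ j)) ≤ M
    tail j j<L = bounded (L ℕ.+ (r ℕ.+ j)) (ℕ.+-monoʳ-< L (ℕ.+-monoʳ-< r j<L))
    lower = begin
      fromℕ r * lo         ≡⟨ ∑-const r lo ⟨
      ∑[ _ < r ] lo        ≤⟨ ∑-mono-≤ r (λ j j<r → proj₁ (middle j j<r)) ⟩
      Sₘ                   ≡⟨ solve 1 (λ x → (Κ 0ℚ ⊕ (x ⊕ Κ 0ℚ)) ⊜ x) refl Sₘ ⟨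
      0ℚ + (Sₘ + 0ℚ)       ≤⟨ +-mono-≤ (∑-nonNeg L (λ j j<L → proj₁ (head j j<L)))
                                       (+-monoʳ-≤ Sₘ (∑-nonNeg L (λ j j<L → proj₁ (tail j j<L)))) ⟩
      Sₕ + (Sₘ + Sₜ)       ≡⟨ split ⟨
      ∑ (L ℕ.+ (r ℕ.+ L)) F ∎
    upper = begin
      ∑ (L ℕ.+ (r ℕ.+ L)) F                          ≡⟨ split ⟩
      Sₕ + (Sₘ + Sₜ)                                 ≤⟨ +-mono-≤ (∑-mono-≤ L (λ j j<L → proj₂ (head j j<L)))
                                                          (+-mono-≤ (∑-mono-≤ r (λ j j<r → proj₂ (middle j j<r)))
                                                                    (∑-mono-≤ L (λ j j<L → proj₂ (tail j j<L)))) ⟩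
      ∑[ _ < L ] M + (∑[ _ < r ] hi + ∑[ _ < L ] M)  ≡⟨ cong₂ (λ u w → u + (w + u)) (∑-const L M) (∑-const r hi) ⟩
      fromℕ L * M + (fromℕ r * hi + fromℕ L * M)     ≡⟨ solve 3 (λ l m h → (l ⊗ m ⊕ (h ⊕ l ⊗ m)) ⊜ ((l ⊕ l) ⊗ m ⊕ h)) refl
                                                              (fromℕ L) M (fromℕ r * hi) ⟩
      (fromℕ L + fromℕ L) * M + fromℕ r * hi         ≡⟨ cong (λ l → l * M + fromℕ r * hi) (fromℕ-+ L L) ⟨
      fromℕ (L ℕ.+ L) * M + fromℕ r * hi             ∎

  Near : ℚ → ℚ → ℚ → Set
  Near y e p = y - e ≤ p × p ≤ y + e

  ∣p-q∣≤e+e : ∀ {p q y e} → Near y e p → Near y e q → ∣ p - q ∣ ≤ e + e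
  ∣p-q∣≤e+e {p} {q} {y} {e} (y-e≤p , p≤y+e) (y-e≤q , q≤y+e) =
    [ bound (p - q) p-q≤e+e , bound (- (p - q)) q-p≤e+e ]′ (∣p∣≡p∨∣p∣≡-p (p - q))
    where
    bound : ∀ d → d ≤ e + e → ∣ p - q ∣ ≡ d → ∣ p - q ∣ ≤ e + e
    bound d d≤e+e ∣p-q∣≡d = subst (_≤ e + e) (sym ∣p-q∣≡d) d≤e+e
    p-q≤e+e : p - q ≤ e + e
    p-q≤e+e = ≤-from-difference
      (solve 4 (λ p q y e → (e ⊕ e ⊕ ⊝ (p ⊕ ⊝ q)) ⊜ (y ⊕ e ⊕ ⊝ p ⊕ (q ⊕ ⊝ (y ⊕ ⊝ e)))) refl p q y e)
      (0≤p+q (p≤q⇒0≤q-p p≤y+e) (p≤q⇒0≤q-p y-e≤q))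
    q-p≤e+e : - (p - q) ≤ e + e
    q-p≤e+e = ≤-from-difference
      (solve 4 (λ p q y e → (e ⊕ e ⊕ ⊝ (⊝ (p ⊕ ⊝ q))) ⊜ (y ⊕ e ⊕ ⊝ q ⊕ (p ⊕ ⊝ (y ⊕ ⊝ e)))) refl p q y e)
      (0≤p+q (p≤q⇒0≤q-p q≤y+e) (p≤q⇒0≤q-p y-e≤p))

module LinearRecurrence (k' : ℕ) where

  open import Data.Nat as ℕ using (ℕ; zero; suc; z≤n; s≤s; _∸_)
  import Data.Nat.Properties as ℕ
  open import Data.Nat.Tactic.RingSolver as ℕ-Solver using ()
  open import Data.Rational
  open import Data.Rational.Properties
  open import Data.Product using (_×_; _,_; ∃-syntax)
  open import Data.Sum using (inj₁; inj₂)
  open import Relation.Binary.PropositionalEquality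
  open import Relation.Nullary using (Dec; yes; no)
  open import Algebra.Definitions.RawSemiring +-*-rawSemiring using (_^_)
  open RationalLemmas
  open import Tactic.RingSolver.NonReflective ℚ-ring using (solve; _⊜_; _⊕_; _⊗_; ⊝_; Κ)

  private
    k : ℕ
    k = suc k'

  Recurrent : (ℕ → ℚ) → Set
  Recurrent f = ∀ t → f (k ℕ.+ t) ≡ ∑[ j < k ] f (j ℕ.+ t)

  Window : (ℕ → Set) → ℕ → Set
  Window P t = ∀ j → j ℕ.< k → P (j ℕ.+ t)

  Recurrent-difference : ∀ {f g} → Recurrent f → Recurrent g → Recurrent (λ u → f u - g u)
  Recurrent-difference {f} {g} f-rec g-rec t =
    trans (cong₂ _-_ (f-rec t) (g-rec t)) (sym (∑-difference k (λ j → f (j ℕ.+ t)) (λ j → g (j ℕ.+ t))))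

  Recurrent-scale : ∀ a {f} → Recurrent f → Recurrent (λ u → a * f u)
  Recurrent-scale a {f} f-rec t = trans (cong (a *_) (f-rec t)) (sym (∑-* k a (λ j → f (j ℕ.+ t))))

  Recurrent-shift : ∀ m {f} → Recurrent f → Recurrent (λ u → f (m ℕ.+ u))
  Recurrent-shift m {f} f-rec t = begin
    f (m ℕ.+ (k ℕ.+ t))                ≡⟨ cong f (swap m k t) ⟩
    f (k ℕ.+ (m ℕ.+ t))                ≡⟨ f-rec (m ℕ.+ t) ⟩
    ∑[ j < k ] f (j ℕ.+ (m ℕ.+ t))     ≡⟨ ∑-cong k (λ j → cong f (swap j m t)) ⟩
    ∑[ j < k ] f (m ℕ.+ (j ℕ.+ t))     ∎
    where open ≡-Reasoning
          swap : ∀ a b c → a ℕ.+ (b ℕ.+ c) ≡ b ℕ.+ (a ℕ.+ c)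
          swap = ℕ-Solver.solve-∀

  window-propagation : ∀ {P} → (∀ t → Window P t → P (k ℕ.+ t)) → ∀ {t} → Window P t → ∀ u → t ℕ.≤ u → P u
  window-propagation {P} closed {t} window u t≤u =
    subst P (ℕ.m∸n+n≡m t≤u) (slide (u ∸ t) 0 (s≤s z≤n))
    where
    step : ∀ {t} → Window P t → Window P (suc t)
    step {t} w j j<k with ℕ.m≤n⇒m<n∨m≡n j<k
    ... | inj₁ 1+j<k = subst P (sym (ℕ.+-suc j t)) (w (suc j) 1+j<k)
    ... | inj₂ 1+j≡k = subst P (trans (cong (ℕ._+ t) (sym 1+j≡k)) (sym (ℕ.+-suc j t))) (closed t w)
    slide : ∀ d → Window P (d ℕ.+ t)
    slide zero    = window
    slide (suc d) = step (slide d)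

  nonNeg-propagation : ∀ {E} → Recurrent E → ∀ {t} → Window (λ u → 0ℚ ≤ E u) t → ∀ u → t ℕ.≤ u → 0ℚ ≤ E u
  nonNeg-propagation {E} E-rec = window-propagation closed
    where closed : ∀ t → Window (λ u → 0ℚ ≤ E u) t → 0ℚ ≤ E (k ℕ.+ t)
          closed t w = subst (0ℚ ≤_) (sym (E-rec t)) (∑-nonNeg k w)

  module Enclosure {X Y : ℕ → ℚ} (X-rec : Recurrent X) (Y-rec : Recurrent Y)
                   {ι : ℚ} (0<ι : 0ℚ < ι) (ι≤1 : ι ≤ 1ℚ)
                   (X-growth : ∀ p d → d ℕ.≤ k → ι * X (d ℕ.+ p) ≤ X p) where

    -- Between a b u says a ≤ Y u / X u ≤ b, without dividing.
    record Between (a b : ℚ) (u : ℕ) : Set where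
      constructor between
      field
        lower : a * X u ≤ Y u
        upper : Y u ≤ b * X u
    open Between public

    lowerGap : ℚ → ℕ → ℚ
    lowerGap a u = Y u - a * X u

    upperGap : ℚ → ℕ → ℚ
    upperGap b u = b * X u - Y u

    δ : ℚ
    δ = ½ * ι

    0<δ : 0ℚ < δ
    0<δ = positive⁻¹ δ {{pos*pos⇒pos ½ {{_}} ι {{positive 0<ι}}}}

    δ≤1 : δ ≤ 1ℚ
    δ≤1 = ≤-from-difference (slack ι) (0≤p+q (0≤p*q 0≤½ (p≤q⇒0≤q-p ι≤1)) 0≤½)
      where slack : ∀ ι → 1ℚ - ½ * ι ≡ ½ * (1ℚ - ι) + ½
            slack = solve 1 (λ ι → (Κ 1ℚ ⊕ ⊝ (Κ ½ ⊗ ι)) ⊜ (Κ ½ ⊗ (Κ 1ℚ ⊕ ⊝ ι) ⊕ Κ ½)) refl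

    open GeometricDecay 0<δ δ≤1 using (^-nonNeg)

    lowerGap-rec : ∀ a → Recurrent (lowerGap a)
    lowerGap-rec a = Recurrent-difference {Y} {λ u → a * X u} Y-rec (Recurrent-scale a {X} X-rec)

    upperGap-rec : ∀ b → Recurrent (upperGap b)
    upperGap-rec b = Recurrent-difference {λ u → b * X u} {Y} (Recurrent-scale b {X} X-rec) Y-rec

    lowerGap-window : ∀ {a b t} → Window (Between a b) t → Window (λ u → 0ℚ ≤ lowerGap a u) t
    lowerGap-window w j j<k = p≤q⇒0≤q-p (lower (w j j<k))

    upperGap-window : ∀ {a b t} → Window (Between a b) t → Window (λ u → 0ℚ ≤ upperGap b u) t
    upperGap-window w j j<k = p≤q⇒0≤q-p (upper (w j j<k))

    between-propagation : ∀ {a b t} → Window (Between a b) t → ∀ u → t ℕ.≤ u → Between a b u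
    between-propagation {a} {b} w u t≤u =
      between (≤-from-difference refl (nonNeg-propagation {lowerGap a} (lowerGap-rec a) (lowerGap-window w) u t≤u))
              (≤-from-difference refl (nonNeg-propagation {upperGap b} (upperGap-rec b) (upperGap-window w) u t≤u))

    boost : ∀ {E} → Recurrent E → ∀ {t} → Window (λ u → 0ℚ ≤ E u) t →
            ∀ {θ} → 0ℚ ≤ θ → θ * X (k' ℕ.+ t) ≤ E (k' ℕ.+ t) →
            Window (λ u → θ * ι * X u ≤ E u) (k ℕ.+ t)
    boost {E} E-rec {t} 0≤E {θ} 0≤θ θX≤E j j<k = begin
      θ * ι * X (j ℕ.+ (k ℕ.+ t))            ≡⟨ cong (λ u → θ * ι * X u) (ℕ.+-suc j (k' ℕ.+ t)) ⟩
      θ * ι * X (suc j ℕ.+ (k' ℕ.+ t))       ≡⟨ *-assoc θ ι _ ⟩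
      θ * (ι * X (suc j ℕ.+ (k' ℕ.+ t)))     ≤⟨ *-monoˡ-≤-nonNeg′ θ 0≤θ (X-growth (k' ℕ.+ t) (suc j) j<k) ⟩
      θ * X (k' ℕ.+ t)                       ≤⟨ θX≤E ⟩
      E (k' ℕ.+ t)                           ≡⟨ cong E (complement j≤k') ⟨
      E (k' ∸ j ℕ.+ (j ℕ.+ t))               ≤⟨ ∑-term k (λ i _ → nonNeg-propagation {E} E-rec 0≤E (i ℕ.+ (j ℕ.+ t)) (t≤ i)) (s≤s (ℕ.m∸n≤m k' j)) ⟩
      ∑[ i < k ] E (i ℕ.+ (j ℕ.+ t))         ≡⟨ E-rec (j ℕ.+ t) ⟨
      E (k ℕ.+ (j ℕ.+ t))                    ≡⟨ cong E (swap k j t) ⟩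
      E (j ℕ.+ (k ℕ.+ t))                    ∎
      where
      open ≤-Reasoning
      j≤k' : j ℕ.≤ k'
      j≤k' = ℕ.≤-pred j<k
      complement : ∀ {j} → j ℕ.≤ k' → k' ∸ j ℕ.+ (j ℕ.+ t) ≡ k' ℕ.+ t
      complement {j} j≤k' = trans (sym (ℕ.+-assoc (k' ∸ j) j t)) (cong (ℕ._+ t) (ℕ.m∸n+n≡m j≤k'))
      t≤ : ∀ i → t ℕ.≤ i ℕ.+ (j ℕ.+ t)
      t≤ i = ℕ.≤-trans (ℕ.m≤n+m t j) (ℕ.m≤n+m (j ℕ.+ t) i)
      swap : ∀ a b c → a ℕ.+ (b ℕ.+ c) ≡ b ℕ.+ (a ℕ.+ c)
      swap = ℕ-Solver.solve-∀

    raise-lower : ∀ {a b t θ} → Window (Between a b) t → 0ℚ ≤ θ → θ * X (k' ℕ.+ t) ≤ lowerGap a (k' ℕ.+ t) →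
                  Window (Between (a + θ * ι) b) (k ℕ.+ t)
    raise-lower {a} {b} {t} {θ} w 0≤θ θX≤gap j j<k = between
      (≤-from-difference (regroup (Y u) (X u) a θ ι)
        (p≤q⇒0≤q-p (boost {lowerGap a} (lowerGap-rec a) (lowerGap-window w) 0≤θ θX≤gap j j<k)))
      (upper (between-propagation w u (ℕ.≤-trans (ℕ.m≤n+m t k) (ℕ.m≤n+m (k ℕ.+ t) j))))
      where u : ℕ
            u = j ℕ.+ (k ℕ.+ t)
            regroup : ∀ y x a θ ι → y - (a + θ * ι) * x ≡ (y - a * x) - θ * ι * x
            regroup = solve 5 (λ y x a θ ι → (y ⊕ ⊝ ((a ⊕ θ ⊗ ι) ⊗ x)) ⊜ (y ⊕ ⊝ (a ⊗ x) ⊕ ⊝ (θ ⊗ ι ⊗ x))) refl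

    lower-upper : ∀ {a b t θ} → Window (Between a b) t → 0ℚ ≤ θ → θ * X (k' ℕ.+ t) ≤ upperGap b (k' ℕ.+ t) →
                  Window (Between a (b - θ * ι)) (k ℕ.+ t)
    lower-upper {a} {b} {t} {θ} w 0≤θ θX≤gap j j<k = between
      (lower (between-propagation w u (ℕ.≤-trans (ℕ.m≤n+m t k) (ℕ.m≤n+m (k ℕ.+ t) j))))
      (≤-from-difference (regroup (Y u) (X u) b θ ι)
        (p≤q⇒0≤q-p (boost {upperGap b} (upperGap-rec b) (upperGap-window w) 0≤θ θX≤gap j j<k)))
      where u : ℕ
            u = j ℕ.+ (k ℕ.+ t)
            regroup : ∀ y x b θ ι → (b - θ * ι) * x - y ≡ (b * x - y) - θ * ι * x
            regroup = solve 5 (λ y x b θ ι → ((b ⊕ ⊝ (θ ⊗ ι)) ⊗ x ⊕ ⊝ y) ⊜ (b ⊗ x ⊕ ⊝ y ⊕ ⊝ (θ ⊗ ι ⊗ x))) refl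

    -- At the last point of the window one of the two gaps is at least half the width,
    -- and boost carries that gap over the whole next window.
    contract : ∀ {a w t} → 0ℚ ≤ w → Window (Between a (a + w)) t →
               ∃[ a' ] (a ≤ a' × a' + w * (1ℚ - δ) ≤ a + w × Window (Between a' (a' + w * (1ℚ - δ))) (k ℕ.+ t))
    contract {a} {w} {t} 0≤w ws = choose (θ * X p ≤? lowerGap a p)
      where
      θ : ℚ
      θ = w * ½
      p : ℕ
      p = k' ℕ.+ t
      0≤θ : 0ℚ ≤ θ
      0≤θ = 0≤p*q 0≤w 0≤½
      0≤θι : 0ℚ ≤ θ * ι
      0≤θι = 0≤p*q 0≤θ (<⇒≤ 0<ι)
      raised : ∀ a w ι → a + w ≡ (a + w * ½ * ι) + w * (1ℚ - ½ * ι)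
      raised = solve 3 (λ a w ι → (a ⊕ w) ⊜ (a ⊕ w ⊗ Κ ½ ⊗ ι ⊕ w ⊗ (Κ 1ℚ ⊕ ⊝ (Κ ½ ⊗ ι)))) refl
      lowered : ∀ a w ι → a + w - w * ½ * ι ≡ a + w * (1ℚ - ½ * ι)
      lowered = solve 3 (λ a w ι → (a ⊕ w ⊕ ⊝ (w ⊗ Κ ½ ⊗ ι)) ⊜ (a ⊕ w ⊗ (Κ 1ℚ ⊕ ⊝ (Κ ½ ⊗ ι)))) refl
      gaps : ∀ a w x y → ((a + w) * x - y) - w * ½ * x ≡ w * ½ * x - (y - a * x)
      gaps = solve 4 (λ a w x y → ((a ⊕ w) ⊗ x ⊕ ⊝ y ⊕ ⊝ (w ⊗ Κ ½ ⊗ x)) ⊜ (w ⊗ Κ ½ ⊗ x ⊕ ⊝ (y ⊕ ⊝ (a ⊗ x)))) refl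
      added : ∀ a d → (a + d) - a ≡ d
      added = solve 2 (λ a d → (a ⊕ d ⊕ ⊝ a) ⊜ d) refl
      shrunk : ∀ a w ι → (a + w) - (a + w * (1ℚ - ½ * ι)) ≡ w * (½ * ι)
      shrunk = solve 3 (λ a w ι → (a ⊕ w ⊕ ⊝ (a ⊕ w ⊗ (Κ 1ℚ ⊕ ⊝ (Κ ½ ⊗ ι)))) ⊜ (w ⊗ (Κ ½ ⊗ ι))) refl
      choose : Dec (θ * X p ≤ lowerGap a p) →
               ∃[ a' ] (a ≤ a' × a' + w * (1ℚ - δ) ≤ a + w × Window (Between a' (a' + w * (1ℚ - δ))) (k ℕ.+ t))
      choose (yes θX≤lower) = a + θ * ι , ≤-from-difference (added a (θ * ι)) 0≤θι , ≤-reflexive (sym (raised a w ι))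
                            , subst (λ b → Window (Between (a + θ * ι) b) (k ℕ.+ t)) (raised a w ι) (raise-lower ws 0≤θ θX≤lower)
      choose (no  θX≰lower) = a , ≤-refl , ≤-from-difference (shrunk a w ι) (0≤p*q 0≤w (<⇒≤ 0<δ))
                            , subst (λ b → Window (Between a b) (k ℕ.+ t)) (lowered a w ι)
                                (lower-upper ws 0≤θ (≤-from-difference (gaps a w (X p) (Y p)) (p≤q⇒0≤q-p (<⇒≤ (≰⇒> θX≰lower)))))

    enclose : ∀ {B} → 0ℚ ≤ B → Window (Between 0ℚ B) 0 → ∀ s →
              ∃[ a ] (0ℚ ≤ a × a + B * (1ℚ - δ) ^ s ≤ B × Window (Between a (a + B * (1ℚ - δ) ^ s)) (s ℕ.* k))
    enclose {B} 0≤B ws zero = 0ℚ , ≤-refl , ≤-reflexive (initial B) , subst (λ b → Window (Between 0ℚ b) 0) (sym (initial B)) ws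
      where initial : ∀ B → 0ℚ + B * 1ℚ ≡ B
            initial = solve 1 (λ B → (Κ 0ℚ ⊕ B ⊗ Κ 1ℚ) ⊜ B) refl
    enclose {B} 0≤B ws (suc s) with enclose 0≤B ws s
    ... | a , 0≤a , a+w≤B , ws' with contract (0≤p*q 0≤B (^-nonNeg s)) ws'
    ... | a' , a≤a' , a'+w'≤a+w , ws'' =
        a' , ≤-trans 0≤a a≤a'
      , subst (λ w → a' + w ≤ B) (reassoc B ((1ℚ - δ) ^ s) (1ℚ - δ)) (≤-trans a'+w'≤a+w a+w≤B)
      , subst (λ w → Window (Between a' (a' + w)) (suc s ℕ.* k)) (reassoc B ((1ℚ - δ) ^ s) (1ℚ - δ)) ws''
      where reassoc : ∀ B p r → B * p * r ≡ B * (r * p)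
            reassoc = solve 3 (λ B p r → (B ⊗ p ⊗ r) ⊜ (B ⊗ (r ⊗ p))) refl

module KBonacci (k' : ℕ) where

  open import Data.Nat as ℕ using (ℕ; zero; suc; z≤n; s≤s; _∸_)
  import Data.Nat.Properties as ℕ
  open import Data.Nat.Tactic.RingSolver as ℕ-Solver using ()
  open import Data.Rational
  open import Data.Rational.Properties
  open import Data.Product using (_×_; _,_; proj₁; proj₂; ∃-syntax)
  open import Function using (_∘_)
  open import Relation.Binary.PropositionalEquality
  open RationalLemmas
  open import Algebra.Definitions.RawSemiring +-*-rawSemiring using (_^_)
  open import Tactic.RingSolver.NonReflective ℚ-ring using (solve; _⊜_; _⊕_; _⊗_; ⊝_; Κ)
  open LinearRecurrence k'
  open Words

  open RunAvoidance k'

  -- c (n + 1) = |B_n(1^k)|; with c 0 = 1 this is the k-bonacci sequence (c-rec).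
  c : ℕ → ℕ
  c zero    = 1
  c (suc n) = #words n k

  #words-1 : ∀ n → #words n 1 ≡ c n
  #words-1 zero    = refl
  #words-1 (suc n) = trans (cong (#words n k ℕ.+_) (#words-0 n)) (ℕ.+-identityʳ _)

  c-pos : ∀ n → 1 ℕ.≤ c n
  c-pos zero    = ℕ.≤-refl
  c-pos (suc n) = #words-pos n k'

  c-doubling : ∀ n → c (suc n) ℕ.≤ 2 ℕ.* c n
  c-doubling zero    = s≤s z≤n
  c-doubling (suc n) = begin
    #words n k ℕ.+ #words n k'           ≤⟨ ℕ.+-monoʳ-≤ (#words n k) (#words-mono n (ℕ.n≤1+n k')) ⟩
    #words n k ℕ.+ #words n k            ≡⟨ cong (#words n k ℕ.+_) (ℕ.+-identityʳ (#words n k)) ⟨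
    2 ℕ.* #words n k                     ∎
    where open ℕ.≤-Reasoning

  c-growth : ∀ d p → c (d ℕ.+ p) ℕ.≤ 2 ℕ.^ d ℕ.* c p
  c-growth zero    p = ℕ.≤-reflexive (sym (ℕ.*-identityˡ (c p)))
  c-growth (suc d) p = begin
    c (suc (d ℕ.+ p))          ≤⟨ c-doubling (d ℕ.+ p) ⟩
    2 ℕ.* c (d ℕ.+ p)          ≤⟨ ℕ.*-monoʳ-≤ 2 (c-growth d p) ⟩
    2 ℕ.* (2 ℕ.^ d ℕ.* c p)      ≡⟨ ℕ.*-assoc 2 (2 ℕ.^ d) (c p) ⟨
    2 ℕ.^ suc d ℕ.* c p          ∎
    where open ℕ.≤-Reasoning

  c-mono : ∀ j m → c m ℕ.≤ c (j ℕ.+ m)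
  c-mono zero    m = ℕ.≤-refl
  c-mono (suc j) m = ℕ.≤-trans (c-mono j m) (c-step (j ℕ.+ m))
    where c-step : ∀ n → c n ℕ.≤ c (suc n)
          c-step zero    = c-pos 1
          c-step (suc n) = ℕ.m≤m+n _ _

  #words-window : ∀ i t → fromℕ (#words (i ℕ.+ t) (suc i)) ≡ ∑[ j < suc i ] fromℕ (c (j ℕ.+ t))
  #words-window zero    t = trans (cong fromℕ (#words-1 t)) (sym (+-identityˡ (fromℕ (c t))))
  #words-window (suc i) t = begin
    fromℕ (#words (i ℕ.+ t) k ℕ.+ #words (i ℕ.+ t) (suc i))        ≡⟨ fromℕ-+ (#words (i ℕ.+ t) k) (#words (i ℕ.+ t) (suc i)) ⟩
    fromℕ (c (suc i ℕ.+ t)) + fromℕ (#words (i ℕ.+ t) (suc i))     ≡⟨ +-comm (fromℕ (c (suc i ℕ.+ t))) (fromℕ (#words (i ℕ.+ t) (suc i))) ⟩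
    fromℕ (#words (i ℕ.+ t) (suc i)) + fromℕ (c (suc i ℕ.+ t))     ≡⟨ cong (_+ fromℕ (c (suc i ℕ.+ t))) (#words-window i t) ⟩
    ∑[ j < suc (suc i) ] fromℕ (c (j ℕ.+ t))                        ∎
    where open ≡-Reasoning

  c-rec : Recurrent (fromℕ ∘ c)
  c-rec t = #words-window k' t

  #zeros-convolution : ∀ n i → fromℕ (#zeros n i) ≡ ∑[ q < n ] (fromℕ (#words q i) * fromℕ (c (n ∸ q)))
  #zeros-convolution zero    i       = refl
  #zeros-convolution (suc n) zero    = sym (begin
    ∑[ q < suc n ] (fromℕ (#words q 0) * fromℕ (c (suc n ∸ q)))  ≡⟨ ∑-cong (suc n) vanish ⟩
    ∑[ _ < suc n ] 0ℚ                                           ≡⟨ ∑-const (suc n) 0ℚ ⟩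
    fromℕ (suc n) * 0ℚ                                          ≡⟨ *-zeroʳ (fromℕ (suc n)) ⟩
    0ℚ                                                          ∎)
    where open ≡-Reasoning
          vanish : ∀ q → fromℕ (#words q 0) * fromℕ (c (suc n ∸ q)) ≡ 0ℚ
          vanish q = trans (cong (λ g → fromℕ g * fromℕ (c (suc n ∸ q))) (#words-0 q)) (*-zeroˡ (fromℕ (c (suc n ∸ q))))
  #zeros-convolution (suc n) (suc i) = begin
    fromℕ (#zeros n k ℕ.+ #words n k ℕ.+ #zeros n i)
      ≡⟨ trans (fromℕ-+ (#zeros n k ℕ.+ #words n k) (#zeros n i)) (cong (_+ fromℕ (#zeros n i)) (fromℕ-+ (#zeros n k) (#words n k))) ⟩
    fromℕ (#zeros n k) + fromℕ (#words n k) + fromℕ (#zeros n i)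
      ≡⟨ regroup (fromℕ (#zeros n k)) (fromℕ (#words n k)) (fromℕ (#zeros n i)) ⟩
    1ℚ * fromℕ (#words n k) + (fromℕ (#zeros n k) + fromℕ (#zeros n i))
      ≡⟨ cong (1ℚ * fromℕ (#words n k) +_) (cong₂ _+_ (#zeros-convolution n k) (#zeros-convolution n i)) ⟩
    1ℚ * fromℕ (#words n k) + (∑[ q < n ] (Gk q * C q) + ∑[ q < n ] (Gi q * C q))
      ≡⟨ cong (1ℚ * fromℕ (#words n k) +_) (∑-+ n (λ q → Gk q * C q) (λ q → Gi q * C q)) ⟨
    1ℚ * fromℕ (#words n k) + ∑[ q < n ] (Gk q * C q + Gi q * C q)
      ≡⟨ cong (1ℚ * fromℕ (#words n k) +_) (∑-cong n (λ q → trans (sym (*-distribʳ-+ (C q) (Gk q) (Gi q)))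
                                                                  (cong (_* C q) (sym (fromℕ-+ (#words q k) (#words q i)))))) ⟩
    1ℚ * fromℕ (#words n k) + ∑[ q < n ] (fromℕ (#words (suc q) (suc i)) * C q)
      ≡⟨ ∑-front n (λ q → fromℕ (#words q (suc i)) * fromℕ (c (suc n ∸ q))) ⟨
    ∑[ q < suc n ] (fromℕ (#words q (suc i)) * fromℕ (c (suc n ∸ q))) ∎
    where open ≡-Reasoning
          Gk Gi C : ℕ → ℚ
          Gk q = fromℕ (#words q k)
          Gi q = fromℕ (#words q i)
          C  q = fromℕ (c (n ∸ q))
          regroup : ∀ z g z' → z + g + z' ≡ 1ℚ * g + (z + z')
          regroup = solve 3 (λ z g z' → (z ⊕ g ⊕ z') ⊜ (Κ 1ℚ ⊗ g ⊕ (z ⊕ z'))) refl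

  2ᵏ : ℕ
  2ᵏ = 2 ℕ.^ k

  c-bounded-growth : ∀ d p → d ℕ.≤ k → c (d ℕ.+ p) ℕ.≤ suc 2ᵏ ℕ.* c p
  c-bounded-growth d p d≤k = ℕ.≤-trans (c-growth d p) (ℕ.*-monoˡ-≤ (c p) (ℕ.≤-trans (ℕ.^-monoʳ-≤ 2 d≤k) (ℕ.n≤1+n 2ᵏ)))

  c-product-bound : ∀ m j → j ℕ.< k → c m ℕ.* c j ℕ.≤ 2ᵏ ℕ.* c (m ℕ.+ j)
  c-product-bound m j j<k = begin
    c m ℕ.* c j                 ≤⟨ ℕ.*-mono-≤ (subst (c m ℕ.≤_) (cong c (ℕ.+-comm j m)) (c-mono j m)) c-j≤2^j ⟩
    c (m ℕ.+ j) ℕ.* 2 ℕ.^ j       ≤⟨ ℕ.*-monoʳ-≤ (c (m ℕ.+ j)) (ℕ.^-monoʳ-≤ 2 (ℕ.<⇒≤ j<k)) ⟩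
    c (m ℕ.+ j) ℕ.* 2ᵏ           ≡⟨ ℕ.*-comm (c (m ℕ.+ j)) 2ᵏ ⟩
    2ᵏ ℕ.* c (m ℕ.+ j)           ∎
    where open ℕ.≤-Reasoning
          c-j≤2^j : c j ℕ.≤ 2 ℕ.^ j
          c-j≤2^j = subst₂ ℕ._≤_ (cong c (ℕ.+-identityʳ j)) (ℕ.*-identityʳ (2 ℕ.^ j)) (c-growth j 0)

  X Y : ℕ → ℕ → ℚ
  X m u = fromℕ (c (m ℕ.+ u))
  Y m u = fromℕ (c m) * fromℕ (c u)

  ι : ℚ
  ι = 1/ fromℕ (suc 2ᵏ)

  0<ι : 0ℚ < ι
  0<ι = positive⁻¹ ι

  ι≤1 : ι ≤ 1ℚ
  ι≤1 = begin
    ι                     ≡⟨ *-identityʳ ι ⟨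
    ι * 1ℚ                ≤⟨ *-monoˡ-≤-nonNeg′ ι (<⇒≤ 0<ι) (fromℕ-mono-≤ {1} {suc 2ᵏ} (s≤s z≤n)) ⟩
    ι * fromℕ (suc 2ᵏ)     ≡⟨ *-inverseˡ (fromℕ (suc 2ᵏ)) ⟩
    1ℚ                    ∎
    where open ≤-Reasoning

  X-growth : ∀ m p d → d ℕ.≤ k → ι * X m (d ℕ.+ p) ≤ X m p
  X-growth m p d d≤k = begin
    ι * X m (d ℕ.+ p)                     ≡⟨ cong (λ n → ι * fromℕ (c n)) (swap m d p) ⟩
    ι * fromℕ (c (d ℕ.+ (m ℕ.+ p)))       ≤⟨ *-monoˡ-≤-nonNeg′ ι (<⇒≤ 0<ι) (fromℕ-mono-≤ (c-bounded-growth d (m ℕ.+ p) d≤k)) ⟩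
    ι * fromℕ (suc 2ᵏ ℕ.* c (m ℕ.+ p))     ≡⟨ cong (ι *_) (fromℕ-* (suc 2ᵏ) (c (m ℕ.+ p))) ⟩
    ι * (fromℕ (suc 2ᵏ) * X m p)           ≡⟨ *-assoc ι (fromℕ (suc 2ᵏ)) (X m p) ⟨
    ι * fromℕ (suc 2ᵏ) * X m p             ≡⟨ cong (_* X m p) (*-inverseˡ (fromℕ (suc 2ᵏ))) ⟩
    1ℚ * X m p                            ≡⟨ *-identityˡ (X m p) ⟩
    X m p                                 ∎
    where open ≤-Reasoning
          swap : ∀ a b c → a ℕ.+ (b ℕ.+ c) ≡ b ℕ.+ (a ℕ.+ c)
          swap = ℕ-Solver.solve-∀

  module E (m : ℕ) = Enclosure {X m} {Y m} (Recurrent-shift m {fromℕ ∘ c} c-rec)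
                                (Recurrent-scale (fromℕ (c m)) {fromℕ ∘ c} c-rec) 0<ι ι≤1 (X-growth m)

  initial-window : ∀ m → Window (E.Between m 0ℚ (fromℕ 2ᵏ)) 0
  initial-window m j j<k = E.between {m}
    (≤-trans (≤-reflexive (*-zeroˡ (X m (j ℕ.+ 0)))) (0≤p*q (0≤fromℕ (c m)) (0≤fromℕ (c (j ℕ.+ 0)))))
    (subst₂ _≤_ (fromℕ-* (c m) (c (j ℕ.+ 0))) (fromℕ-* 2ᵏ (c (m ℕ.+ (j ℕ.+ 0)))) (fromℕ-mono-≤ (c-product-bound m (j ℕ.+ 0) j+0<k)))
    where j+0<k : j ℕ.+ 0 ℕ.< k
          j+0<k = subst (ℕ._< k) (sym (ℕ.+-identityʳ j)) j<k

  ratio-bounded : ∀ m u → E.Between m 0ℚ (fromℕ 2ᵏ) u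
  ratio-bounded m u = E.between-propagation m (initial-window m) u z≤n

  open GeometricDecay (E.0<δ 0) (E.δ≤1 0) using (geometric-decay; ^-nonNeg)

  width : ℕ → ℚ
  width s = fromℕ 2ᵏ * (1ℚ - ½ * ι) ^ s

  enclosure : ∀ s m → ∃[ a ] (0ℚ ≤ a × a + width s ≤ fromℕ 2ᵏ × (∀ u → s ℕ.* k ℕ.≤ u → E.Between m a (a + width s) u))
  enclosure s m =
    let a , 0≤a , a+w≤2ᵏ , window = E.enclose m (0≤fromℕ 2ᵏ) (initial-window m) s
    in  a , 0≤a , a+w≤2ᵏ , E.between-propagation m window

  -- Both enclosures contain the ratio at (m, L), which is also the ratio at (L, m).
  enclosures-overlap : ∀ {m L a b x y} → E.Between m a b L → E.Between L x y m → a ≤ y × x ≤ b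
  enclosures-overlap {m} {L} {a} {b} {x} {y} at-m at-L =
      *-cancelʳ-≤-pos′ (X m L) 0<X (≤-trans (E.lower {m} at-m) (subst₂ (λ Y′ X′ → Y′ ≤ y * X′) Y-sym X-sym (E.upper {L} at-L)))
    , *-cancelʳ-≤-pos′ (X m L) 0<X (≤-trans (subst₂ (λ Y′ X′ → x * X′ ≤ Y′) Y-sym X-sym (E.lower {L} at-L)) (E.upper {m} at-m))
    where
    0<X : 0ℚ < X m L
    0<X = fromℕ-mono-< {0} (c-pos (m ℕ.+ L))
    X-sym : X L m ≡ X m L
    X-sym = cong (fromℕ ∘ c) (ℕ.+-comm L m)
    Y-sym : Y L m ≡ Y m L
    Y-sym = *-comm (fromℕ (c L)) (fromℕ (c m))

  ratio-cauchy : ∀ {ε} → 0ℚ < ε →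
                 ∃[ L ] ∃[ x ] (0ℚ ≤ x × x ≤ fromℕ 2ᵏ × ∀ m u → L ℕ.≤ m → L ℕ.≤ u → E.Between m (x - ε) (x + ε) u)
  ratio-cauchy {ε} 0<ε = L , x , 0≤x , ≤-trans (≤-from-difference (added x w) 0≤w) x+w≤2ᵏ , near
    where
    decay : ∃[ s ] width s ≤ ε * ½
    decay = geometric-decay 2ᵏ (positive⁻¹ (ε * ½) {{pos*pos⇒pos ε {{positive 0<ε}} ½}})
    s L : ℕ
    s = proj₁ decay
    L = s ℕ.* k
    w : ℚ
    w = width s
    0≤w : 0ℚ ≤ w
    0≤w = 0≤p*q (0≤fromℕ 2ᵏ) (^-nonNeg s)
    2w≤ε : w + w ≤ ε
    2w≤ε = ≤-trans (+-mono-≤ (proj₂ decay) (proj₂ decay)) (≤-reflexive (solve 1 (λ ε → (ε ⊗ Κ ½ ⊕ ε ⊗ Κ ½) ⊜ ε) refl ε))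
    added : ∀ x w → (x + w) - x ≡ w
    added = solve 2 (λ x w → (x ⊕ w ⊕ ⊝ x) ⊜ w) refl
    x : ℚ
    x = proj₁ (enclosure s L)
    0≤x : 0ℚ ≤ x
    0≤x = proj₁ (proj₂ (enclosure s L))
    x+w≤2ᵏ : x + w ≤ fromℕ 2ᵏ
    x+w≤2ᵏ = proj₁ (proj₂ (proj₂ (enclosure s L)))
    near : ∀ m u → L ℕ.≤ m → L ℕ.≤ u → E.Between m (x - ε) (x + ε) u
    near m u L≤m L≤u = E.between {m}
      (≤-trans (*-monoʳ-≤-nonNeg′ (X m u) (0≤fromℕ (c (m ℕ.+ u))) (proj₁ close)) (E.lower {m} (at-m u L≤u)))
      (≤-trans (E.upper {m} (at-m u L≤u)) (*-monoʳ-≤-nonNeg′ (X m u) (0≤fromℕ (c (m ℕ.+ u))) (proj₂ close)))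
      where
      a : ℚ
      a = proj₁ (enclosure s m)
      at-m : ∀ v → L ℕ.≤ v → E.Between m a (a + w) v
      at-m = proj₂ (proj₂ (proj₂ (enclosure s m)))
      overlaps : a ≤ x + w × x ≤ a + w
      overlaps = enclosures-overlap (at-m L ℕ.≤-refl) (proj₂ (proj₂ (proj₂ (enclosure s L))) m L≤m)
      close : x - ε ≤ a × a + w ≤ x + ε
      close = overlapping-intervals {a} {x} {w} {ε} (proj₁ overlaps) (proj₂ overlaps) 0≤w 2w≤ε

open import Defs
open import Data.Nat as ℕ using (ℕ; suc; _∸_; _≥_)
import Data.Nat.Properties as ℕ
open import Data.Nat.Tactic.RingSolver as ℕ-Solver using ()
open import Data.List using (length)
open import Data.Rational hiding (_≥_)
open import Data.Rational.Properties
open import Data.Product using (_×_; _,_; proj₁; proj₂; ∃-syntax)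
open import Function using (_∘_)
open import Relation.Binary.PropositionalEquality
open RationalLemmas
open import Tactic.RingSolver.NonReflective ℚ-ring using (solve; _⊜_; _⊕_; _⊗_; ⊝_; Κ)
open Words

ratio-* : ∀ p {q} → 1 ℕ.≤ q → ratio p q * fromℕ q ≡ fromℕ p
ratio-* p {suc q} _ = /-*-denominator p q

near-half : ∀ {A V Z K} → 0ℚ < V + Z → A * (V + Z) ≡ V → V ≤ Z → K * Z ≤ K * V + (V + Z) → A ≤ ½ × K * (½ - A) ≤ ½
near-half {A} {V} {Z} {K} 0<P A*P≡V V≤Z KZ≤KV+P = ≤-from-difference refl 0≤½-A , K[½-A]≤½
  where
  open ≡-Reasoning
  P = V + Z
  deficit : (½ - A) * P ≡ ½ * (Z - V)
  deficit = begin
    (½ - A) * P           ≡⟨ *-distribʳ-+ P ½ (- A) ⟩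
    ½ * P + - A * P       ≡⟨ cong (λ y → ½ * P + y) (trans (sym (neg-distribˡ-* A P)) (cong -_ A*P≡V)) ⟩
    ½ * (V + Z) - V       ≡⟨ solve 2 (λ V Z → (Κ ½ ⊗ (V ⊕ Z) ⊕ ⊝ V) ⊜ (Κ ½ ⊗ (Z ⊕ ⊝ V))) refl V Z ⟩
    ½ * (Z - V)           ∎
  0≤½-A : 0ℚ ≤ ½ - A
  0≤½-A = *-cancelʳ-≤-pos′ P 0<P (subst₂ _≤_ (sym (*-zeroˡ P)) (sym deficit) (0≤p*q 0≤½ (p≤q⇒0≤q-p V≤Z)))
  K[½-A]≤½ : K * (½ - A) ≤ ½
  K[½-A]≤½ = *-cancelʳ-≤-pos′ P 0<P (≤-from-difference (begin
    ½ * P - K * (½ - A) * P           ≡⟨ cong (λ y → ½ * P - y) (*-assoc K (½ - A) P) ⟩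
    ½ * P - K * ((½ - A) * P)         ≡⟨ cong (λ d → ½ * P - K * d) deficit ⟩
    ½ * (V + Z) - K * (½ * (Z - V))   ≡⟨ solve 3 (λ K V Z → (Κ ½ ⊗ (V ⊕ Z) ⊕ ⊝ (K ⊗ (Κ ½ ⊗ (Z ⊕ ⊝ V))))
                                                         ⊜ (Κ ½ ⊗ (K ⊗ V ⊕ (V ⊕ Z) ⊕ ⊝ (K ⊗ Z)))) refl K V Z ⟩
    ½ * (K * V + (V + Z) - K * Z)     ∎) (0≤p*q 0≤½ (p≤q⇒0≤q-p KZ≤KV+P)))

average-bounds : ∀ {Z C x t M D R} → 0ℚ ≤ C → 0ℚ ≤ x → x ≤ M → 0ℚ ≤ t → 0ℚ ≤ D →
                 R * ((x - t) * C) ≤ Z → Z ≤ D * (M * C) + R * ((x + t) * C) → D * M ≤ t * (D + R) →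
                 (x - (t + t)) * ((D + R) * C) ≤ Z × Z ≤ (x + (t + t)) * ((D + R) * C)
average-bounds {Z} {C} {x} {t} {M} {D} {R} 0≤C 0≤x x≤M 0≤t 0≤D lo≤Z Z≤hi DM≤t[D+R] =
    ≤-from-difference (lower Z C x t M D R)
      (0≤p+q (0≤p+q (0≤p+q (p≤q⇒0≤q-p lo≤Z) slack) (0≤p*q (0≤p*q 0≤C 0≤D) (p≤q⇒0≤q-p x≤M))) (0≤p*q (0≤p*q 0≤t 0≤D) 0≤C))
  , ≤-from-difference (upper Z C x t M D R)
      (0≤p+q (0≤p+q (0≤p+q (p≤q⇒0≤q-p Z≤hi) slack) (0≤p*q (0≤p*q 0≤x 0≤D) 0≤C)) (0≤p*q (0≤p*q 0≤t 0≤D) 0≤C))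
  where
  slack : 0ℚ ≤ C * (t * (D + R) - D * M)
  slack = 0≤p*q 0≤C (p≤q⇒0≤q-p DM≤t[D+R])
  lower : ∀ Z C x t M D R → Z - (x - (t + t)) * ((D + R) * C)
                           ≡ (Z - R * ((x - t) * C)) + C * (t * (D + R) - D * M) + C * D * (M - x) + t * D * C
  lower = solve 7 (λ Z C x t M D R → (Z ⊕ ⊝ ((x ⊕ ⊝ (t ⊕ t)) ⊗ ((D ⊕ R) ⊗ C))) ⊜ (Z ⊕ ⊝ (R ⊗ ((x ⊕ ⊝ t) ⊗ C)) ⊕ C ⊗ (t ⊗ (D ⊕ R) ⊕ ⊝ (D ⊗ M)) ⊕ C ⊗ D ⊗ (M ⊕ ⊝ x) ⊕ t ⊗ D ⊗ C)) refl
  upper : ∀ Z C x t M D R → (x + (t + t)) * ((D + R) * C) - Z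
                           ≡ ((D * (M * C) + R * ((x + t) * C)) - Z) + C * (t * (D + R) - D * M) + x * D * C + t * D * C
  upper = solve 7 (λ Z C x t M D R → ((x ⊕ (t ⊕ t)) ⊗ ((D ⊕ R) ⊗ C) ⊕ ⊝ Z) ⊜ (D ⊗ (M ⊗ C) ⊕ R ⊗ ((x ⊕ t) ⊗ C) ⊕ ⊝ Z ⊕ C ⊗ (t ⊗ (D ⊕ R) ⊕ ⊝ (D ⊗ M)) ⊕ x ⊗ D ⊗ C ⊕ t ⊗ D ⊗ C)) refl

close-to-half : ∀ {A K ε} → 0ℚ < ε → 1ℚ ≤ K * ε → A ≤ ½ → K * (½ - A) ≤ ½ → ∣ A - ½ ∣ < ε
close-to-half {A} {K} {ε} 0<ε 1≤Kε A≤½ K[½-A]≤½ = begin-strict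
  ∣ A - ½ ∣              ≡⟨ trans (cong ∣_∣ (flip A ½)) (trans (∣-p∣≡∣p∣ (½ - A)) (0≤p⇒∣p∣≡p 0≤½-A)) ⟩
  ½ - A                  ≡⟨ *-identityʳ (½ - A) ⟨
  (½ - A) * 1ℚ           ≤⟨ *-monoˡ-≤-nonNeg′ (½ - A) 0≤½-A 1≤Kε ⟩
  (½ - A) * (K * ε)      ≡⟨ regroup (½ - A) K ε ⟩
  ε * (K * (½ - A))      ≤⟨ *-monoˡ-≤-nonNeg′ ε (<⇒≤ 0<ε) K[½-A]≤½ ⟩
  ε * ½                  <⟨ *-monoʳ-<-pos ε {{positive 0<ε}} ½<1 ⟩
  ε * 1ℚ                 ≡⟨ *-identityʳ ε ⟩
  ε                      ∎
  where open ≤-Reasoning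
        0≤½-A = p≤q⇒0≤q-p A≤½
        flip : ∀ A h → A - h ≡ - (h - A)
        flip = solve 2 (λ A h → (A ⊕ ⊝ h) ⊜ (⊝ (h ⊕ ⊝ A))) refl
        regroup : ∀ d K ε → d * (K * ε) ≡ ε * (K * d)
        regroup = solve 3 (λ d K ε → (d ⊗ (K ⊗ ε)) ⊜ (ε ⊗ (K ⊗ d))) refl

module _ (k' : ℕ) where

  open RunAvoidance k'
  open KBonacci k'

  #letters : ℕ → ℕ
  #letters n = #ones n k ℕ.+ #zeros n k

  #letters-pos : ∀ {n} → 1 ℕ.≤ n → 1 ℕ.≤ #letters n
  #letters-pos {n} 1≤n = subst (1 ℕ.≤_) (sym (#ones+#zeros n k)) (ℕ.*-mono-≤ 1≤n (#words-pos n k'))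

  fromℕ-#letters : ∀ n → fromℕ (#letters n) ≡ fromℕ (#ones n k) + fromℕ (#zeros n k)
  fromℕ-#letters n = fromℕ-+ (#ones n k) (#zeros n k)

  a*#letters≡#ones : ∀ {n} → 1 ℕ.≤ n → a n k * fromℕ (#letters n) ≡ fromℕ (#ones n k)
  a*#letters≡#ones {n} 1≤n = begin
    ratio (v n k) (n ℕ.* length (B n k)) * fromℕ (#letters n)  ≡⟨ cong (_* fromℕ (#letters n)) (cong₂ ratio (v≡#ones n) count) ⟩
    ratio (#ones n k) (#letters n) * fromℕ (#letters n)        ≡⟨ ratio-* (#ones n k) (#letters-pos 1≤n) ⟩
    fromℕ (#ones n k)                                          ∎
    where open ≡-Reasoning
          count : n ℕ.* length (B n k) ≡ #letters n
          count = trans (cong (n ℕ.*_) (length-B n)) (sym (#ones+#zeros n k))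

  a-near-half : ∀ {n} → 1 ℕ.≤ n → a n k ≤ ½ × fromℕ k * (½ - a n k) ≤ ½
  a-near-half {n} 1≤n = near-half
    (subst (0ℚ <_) (fromℕ-#letters n) (fromℕ-mono-< {0} (#letters-pos 1≤n)))
    (trans (cong (a n k *_) (sym (fromℕ-#letters n))) (a*#letters≡#ones 1≤n))
    (fromℕ-mono-≤ (#ones≤#zeros n ℕ.≤-refl))
    (subst₂ _≤_ (fromℕ-* k (#zeros n k))
                (trans (fromℕ-+ (k ℕ.* #ones n k) (#letters n)) (cong₂ _+_ (fromℕ-* k (#ones n k)) (fromℕ-#letters n)))
                (fromℕ-mono-≤ zeros-bound))
    where
    zeros-bound : k ℕ.* #zeros n k ℕ.≤ k ℕ.* #ones n k ℕ.+ #letters n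
    zeros-bound = subst (λ m → k ℕ.* #zeros n k ℕ.≤ k ℕ.* #ones n k ℕ.+ m)
                        (trans (cong (ℕ._* #words n k) (ℕ.+-identityʳ n)) (sym (#ones+#zeros n k)))
                        (#zeros-bound n 0 (ℕ.+-identityʳ k))

  a-near-½ : ∀ {ε n} → 0ℚ < ε → 1ℚ ≤ fromℕ k * ε → 1 ℕ.≤ n → ∣ a n k - ½ ∣ < ε
  a-near-½ 0<ε 1≤kε 1≤n = close-to-half {K = fromℕ k} 0<ε 1≤kε (proj₁ (a-near-half 1≤n)) (proj₂ (a-near-half 1≤n))

  a-via-zeros : ∀ {n} → 1 ℕ.≤ n → a n k * (fromℕ n * fromℕ (c (suc n))) ≡ fromℕ n * fromℕ (c (suc n)) - fromℕ (#zeros n k)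
  a-via-zeros {n} 1≤n = begin
    a n k * (fromℕ n * fromℕ (#words n k))               ≡⟨ cong (a n k *_) n*c≡#letters ⟩
    a n k * fromℕ (#letters n)                           ≡⟨ a*#letters≡#ones 1≤n ⟩
    fromℕ (#ones n k)                                    ≡⟨ solve 2 (λ v z → (v ⊕ z ⊕ ⊝ z) ⊜ v) refl (fromℕ (#ones n k)) (fromℕ (#zeros n k)) ⟨
    fromℕ (#ones n k) + fromℕ (#zeros n k) - fromℕ (#zeros n k) ≡⟨ cong (_- fromℕ (#zeros n k)) (fromℕ-#letters n) ⟨
    fromℕ (#letters n) - fromℕ (#zeros n k)              ≡⟨ cong (_- fromℕ (#zeros n k)) n*c≡#letters ⟨
    fromℕ n * fromℕ (#words n k) - fromℕ (#zeros n k)    ∎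
    where open ≡-Reasoning
          n*c≡#letters : fromℕ n * fromℕ (#words n k) ≡ fromℕ (#letters n)
          n*c≡#letters = trans (sym (fromℕ-* n (#words n k))) (cong fromℕ (sym (#ones+#zeros n k)))

  -- #zeros n is n · c (n + 1) times the mean of the ratios at (q + 1, n ∸ q) for q < n;
  -- all but the first and last L of them lie within t of x.
  zeros-bounds : ∀ {L x t} → 0ℚ ≤ x → x ≤ fromℕ 2ᵏ → 0ℚ ≤ t →
                 (∀ m u → L ℕ.≤ m → L ℕ.≤ u → E.Between m (x - t) (x + t) u) →
                 ∀ r → let n = L ℕ.+ (r ℕ.+ L) in fromℕ (L ℕ.+ L) * fromℕ 2ᵏ ≤ t * fromℕ n →
                 (x - (t + t)) * (fromℕ n * fromℕ (c (suc n))) ≤ fromℕ (#zeros n k)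
                 × fromℕ (#zeros n k) ≤ (x + (t + t)) * (fromℕ n * fromℕ (c (suc n)))
  zeros-bounds {L} {x} {t} 0≤x x≤2ᵏ 0≤t near r 2L2ᵏ≤tn =
    subst (λ d → (x - (t + t)) * (d * C) ≤ Z × Z ≤ (x + (t + t)) * (d * C)) (sym n≡2L+r)
      (average-bounds (0≤fromℕ (c (suc n))) 0≤x x≤2ᵏ 0≤t (0≤fromℕ (L ℕ.+ L))
        (subst (fromℕ r * ((x - t) * C) ≤_) (sym Z≡∑) (proj₁ averaged))
        (subst (_≤ fromℕ (L ℕ.+ L) * (fromℕ 2ᵏ * C) + fromℕ r * ((x + t) * C)) (sym Z≡∑) (proj₂ averaged))
        (subst (λ d → fromℕ (L ℕ.+ L) * fromℕ 2ᵏ ≤ t * d) n≡2L+r 2L2ᵏ≤tn))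
    where
    n : ℕ
    n = L ℕ.+ (r ℕ.+ L)
    C Z : ℚ
    C = fromℕ (c (suc n))
    Z = fromℕ (#zeros n k)
    F : ℕ → ℚ
    F q = Y (suc q) (n ∸ q)
    Z≡∑ : Z ≡ ∑ n F
    Z≡∑ = #zeros-convolution n k
    n≡2L+r : fromℕ n ≡ fromℕ (L ℕ.+ L) + fromℕ r
    n≡2L+r = trans (cong fromℕ (rearrange L r)) (fromℕ-+ (L ℕ.+ L) r)
      where rearrange : ∀ L r → L ℕ.+ (r ℕ.+ L) ≡ L ℕ.+ L ℕ.+ r
            rearrange = ℕ-Solver.solve-∀
    X≡C : ∀ {q} → q ℕ.≤ n → X (suc q) (n ∸ q) ≡ C
    X≡C q≤n = cong (fromℕ ∘ c ∘ suc) (ℕ.m+[n∸m]≡n q≤n)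
    bounded : ∀ q → q ℕ.< n → 0ℚ ≤ F q × F q ≤ fromℕ 2ᵏ * C
    bounded q q<n = 0≤p*q (0≤fromℕ (c (suc q))) (0≤fromℕ (c (n ∸ q)))
                  , subst (λ X′ → F q ≤ fromℕ 2ᵏ * X′) (X≡C (ℕ.<⇒≤ q<n)) (E.upper {suc q} (ratio-bounded (suc q) (n ∸ q)))
    middle : ∀ j → j ℕ.< r → (x - t) * C ≤ F (L ℕ.+ j) × F (L ℕ.+ j) ≤ (x + t) * C
    middle j j<r = subst (λ X′ → (x - t) * X′ ≤ F (L ℕ.+ j)) (X≡C q≤n) (E.lower {suc q} inside)
                 , subst (λ X′ → F (L ℕ.+ j) ≤ (x + t) * X′) (X≡C q≤n) (E.upper {suc q} inside)
      where
      q : ℕ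
      q = L ℕ.+ j
      q≤n : q ℕ.≤ n
      q≤n = ℕ.+-monoʳ-≤ L (ℕ.≤-trans (ℕ.<⇒≤ j<r) (ℕ.m≤m+n r L))
      L≤n∸q : L ℕ.≤ n ∸ q
      L≤n∸q = subst (L ℕ.≤_) (sym (trans (ℕ.[m+n]∸[m+o]≡n∸o L (r ℕ.+ L) j) (ℕ.+-∸-comm L (ℕ.<⇒≤ j<r))))
                    (ℕ.m≤n+m L (r ∸ j))
      inside : E.Between (suc q) (x - t) (x + t) (n ∸ q)
      inside = near (suc q) (n ∸ q) (ℕ.≤-trans (ℕ.m≤m+n L j) (ℕ.n≤1+n q)) L≤n∸q
    averaged : fromℕ r * ((x - t) * C) ≤ ∑ n F × ∑ n F ≤ fromℕ (L ℕ.+ L) * (fromℕ 2ᵏ * C) + fromℕ r * ((x + t) * C)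
    averaged = ∑-middle-bounds L r bounded middle

  a-near-limit : ∀ {L x t} → 0ℚ ≤ x → x ≤ fromℕ 2ᵏ → 0ℚ ≤ t →
                 (∀ m u → L ℕ.≤ m → L ℕ.≤ u → E.Between m (x - t) (x + t) u) →
                 ∀ {n} → 1 ℕ.≤ n → L ℕ.+ L ℕ.≤ n → fromℕ (L ℕ.+ L) * fromℕ 2ᵏ ≤ t * fromℕ n → Near (1ℚ - x) (t + t) (a n k)
  a-near-limit {L} {x} {t} 0≤x x≤2ᵏ 0≤t near {n} 1≤n 2L≤n 2L2ᵏ≤tn =
    subst (λ m → Near (1ℚ - x) (t + t) (a m k)) n′≡n
      (near-n′ (subst (1 ℕ.≤_) (sym n′≡n) 1≤n) (subst (λ m → fromℕ (L ℕ.+ L) * fromℕ 2ᵏ ≤ t * fromℕ m) (sym n′≡n) 2L2ᵏ≤tn))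
    where
    r n′ : ℕ
    r = n ∸ (L ℕ.+ L)
    n′ = L ℕ.+ (r ℕ.+ L)
    n′≡n : n′ ≡ n
    n′≡n = trans (rearrange L r) (ℕ.m+[n∸m]≡n 2L≤n)
      where rearrange : ∀ L r → L ℕ.+ (r ℕ.+ L) ≡ L ℕ.+ L ℕ.+ r
            rearrange = ℕ-Solver.solve-∀
    near-n′ : 1 ℕ.≤ n′ → fromℕ (L ℕ.+ L) * fromℕ 2ᵏ ≤ t * fromℕ n′ → Near (1ℚ - x) (t + t) (a n′ k)
    near-n′ 1≤n′ 2L2ᵏ≤tn′ =
        *-cancelʳ-≤-pos′ P 0<P (≤-from-difference
          (trans (cong (λ aP → aP - ((1ℚ - x) - (t + t)) * P) (a-via-zeros 1≤n′)) (lower P Z x t))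
          (p≤q⇒0≤q-p (proj₂ Z-bounds)))
      , *-cancelʳ-≤-pos′ P 0<P (≤-from-difference
          (trans (cong (λ aP → ((1ℚ - x) + (t + t)) * P - aP) (a-via-zeros 1≤n′)) (upper P Z x t))
          (p≤q⇒0≤q-p (proj₁ Z-bounds)))
      where
      P Z : ℚ
      P = fromℕ n′ * fromℕ (c (suc n′))
      Z = fromℕ (#zeros n′ k)
      0<P : 0ℚ < P
      0<P = subst (0ℚ <_) (fromℕ-* n′ (c (suc n′))) (fromℕ-mono-< {0} (ℕ.*-mono-≤ 1≤n′ (c-pos (suc n′))))
      Z-bounds : (x - (t + t)) * P ≤ Z × Z ≤ (x + (t + t)) * P
      Z-bounds = zeros-bounds 0≤x x≤2ᵏ 0≤t near r 2L2ᵏ≤tn′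
      lower : ∀ P Z x t → (P - Z) - ((1ℚ - x) - (t + t)) * P ≡ (x + (t + t)) * P - Z
      lower = solve 4 (λ P Z x t → (P ⊕ ⊝ Z ⊕ ⊝ ((Κ 1ℚ ⊕ ⊝ x ⊕ ⊝ (t ⊕ t)) ⊗ P)) ⊜ ((x ⊕ (t ⊕ t)) ⊗ P ⊕ ⊝ Z)) refl
      upper : ∀ P Z x t → ((1ℚ - x) + (t + t)) * P - (P - Z) ≡ Z - (x - (t + t)) * P
      upper = solve 4 (λ P Z x t → ((Κ 1ℚ ⊕ ⊝ x ⊕ (t ⊕ t)) ⊗ P ⊕ ⊝ (P ⊕ ⊝ Z)) ⊜ (Z ⊕ ⊝ ((x ⊕ ⊝ (t ⊕ t)) ⊗ P))) refl

  a-cauchy : ∀ {ε} → 0ℚ < ε → ∃[ N ] (∀ m n → 1 ℕ.≤ m → 1 ℕ.≤ n → N ℕ.≤ m → N ℕ.≤ n → ∣ a m k - a n k ∣ < ε)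
  a-cauchy {ε} 0<ε =
    let L , x , 0≤x , x≤2ᵏ , near = ratio-cauchy 0<t
        K , 2L2ᵏ≤Kt = archimedean 0<t ((L ℕ.+ L) ℕ.* 2ᵏ)
        close : ∀ {n} → 1 ℕ.≤ n → K ℕ.+ (L ℕ.+ L) ℕ.≤ n → Near (1ℚ - x) (t + t) (a n k)
        close {n} 1≤n N≤n = a-near-limit 0≤x x≤2ᵏ (<⇒≤ 0<t) near 1≤n (ℕ.≤-trans (ℕ.m≤n+m (L ℕ.+ L) K) N≤n) (begin
          fromℕ (L ℕ.+ L) * fromℕ 2ᵏ   ≡⟨ fromℕ-* (L ℕ.+ L) 2ᵏ ⟨
          fromℕ ((L ℕ.+ L) ℕ.* 2ᵏ)     ≤⟨ 2L2ᵏ≤Kt ⟩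
          fromℕ K * t                  ≤⟨ *-monoʳ-≤-nonNeg′ t (<⇒≤ 0<t) (fromℕ-mono-≤ (ℕ.≤-trans (ℕ.m≤m+n K (L ℕ.+ L)) N≤n)) ⟩
          fromℕ n * t                  ≡⟨ *-comm (fromℕ n) t ⟩
          t * fromℕ n                  ∎)
    in  K ℕ.+ (L ℕ.+ L) , λ m n 1≤m 1≤n N≤m N≤n → ≤-<-trans (∣p-q∣≤e+e {y = 1ℚ - x} {e = t + t} (close 1≤m N≤m) (close 1≤n N≤n)) 4t<ε
    where
    open ≤-Reasoning
    t : ℚ
    t = ε * ½ * ½ * ½
    0<t : 0ℚ < t
    0<t = positive⁻¹ t {{pos*pos⇒pos (ε * ½ * ½) {{pos*pos⇒pos (ε * ½) {{pos*pos⇒pos ε {{positive 0<ε}} ½}} ½}} ½}}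
    4t<ε : (t + t) + (t + t) < ε
    4t<ε = begin-strict
      (t + t) + (t + t)   ≡⟨ solve 1 (λ ε → (ε ⊗ Κ ½ ⊗ Κ ½ ⊗ Κ ½ ⊕ ε ⊗ Κ ½ ⊗ Κ ½ ⊗ Κ ½ ⊕ (ε ⊗ Κ ½ ⊗ Κ ½ ⊗ Κ ½ ⊕ ε ⊗ Κ ½ ⊗ Κ ½ ⊗ Κ ½))
                                   ⊜ (ε ⊗ Κ ½)) refl ε ⟩
      ε * ½               <⟨ *-monoʳ-<-pos ε {{positive 0<ε}} ½<1 ⟩
      ε * 1ℚ              ≡⟨ *-identityʳ ε ⟩
      ε                   ∎

corollary1 : ((k : ℕ) → k ≥ 2 → (ε : ℚ) → 0ℚ < ε →
                  ∃[ N ] ((m n : ℕ) → m ≥ 1 → n ≥ 1 → m ≥ N → n ≥ N → ∣ a m k - a n k ∣ < ε))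
               × ((ε : ℚ) → 0ℚ < ε →
                  ∃[ K ] ((k : ℕ) → k ≥ 2 → k ≥ K →
                    ∃[ N ] ((n : ℕ) → n ≥ 1 → n ≥ N → ∣ a n k - ½ ∣ < ε)))
corollary1 = cauchy , limit
  where
  cauchy : (k : ℕ) → k ≥ 2 → (ε : ℚ) → 0ℚ < ε →
           ∃[ N ] ((m n : ℕ) → m ≥ 1 → n ≥ 1 → m ≥ N → n ≥ N → ∣ a m k - a n k ∣ < ε)
  cauchy (suc k') _ ε 0<ε = a-cauchy k' 0<ε
  limit : (ε : ℚ) → 0ℚ < ε → ∃[ K ] ((k : ℕ) → k ≥ 2 → k ≥ K → ∃[ N ] ((n : ℕ) → n ≥ 1 → n ≥ N → ∣ a n k - ½ ∣ < ε))
  limit ε 0<ε =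
    let K , 1≤Kε = archimedean 0<ε 1
    in  K , λ { (suc k') _ K≤k → 1 , λ n 1≤n _ →
                 a-near-½ k' 0<ε (≤-trans 1≤Kε (*-monoʳ-≤-nonNeg′ ε (<⇒≤ 0<ε) (fromℕ-mono-≤ K≤k))) 1≤n }
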